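{- Let $\Delta$ be a simplicial LRB (possibly non-associative) whose projection maps $(F,C)\mapsto FC$ satisfy the projection axioms (P1)–(P3). (Labelled case) If $\Delta$ is labelled by $I$, then $h_J(\Delta)=h_J(D)$ for all chambers $D$ and all $J\subseteq I$ if and only if $\sigma_I\sigma_J=\sigma_J\sigma_I$ for all $J\subseteq I$. (Unlabelled case) If $\Delta$ has rank $n$, then $h_j(\Delta)=h_j(D)$ for all chambers $D$ and all $0\le j\le n$ if and only if $\sigma_n\sigma_j=\sigma_j\sigma_n$ for all $0\le j\le n$.
   Context: A (possibly non-associative) left regular band (LRB) is a set with a binary operation and identity such that $xyx:=(xy)x=x(yx)$ is well defined, $x^2=x$ and $xyx=xy$ for all $x,y$; it carries the relation $x\le y$ iff $xy=y$. A simplicial LRB is one whose underlying set is the set $\mathcal{F}$ of faces (including the empty face, the identity) of a finite pure simplicial complex, with $\le$ equal to the face relation; its chambers $\mathcal{C}$ (maximal faces) satisfy $CF=C$ for all $F$, and the projection of $C$ on $F$ is the product $FC\in\mathcal{C}$. Axioms: (P1)(i) $FC=D\Rightarrow F\le D$; (ii) $F\le C\Rightarrow FC=C$; (iii) $FC=D$ and $F\le G\le D\Rightarrow GC=D$; (P2) if $F\le D$ and $GC=D$ for all codimension-one faces $G$ of $D$ with $F\le G$, then $FC=D$; (P3) if $FC=D$ and $C_1,\dots,C_n=D$ is a weak $C$-gallery (faces $F_i$ with $F_iC=C_i$, $F_i\le C_i,C_{i+1}$) then $FC_1=D$. For chambers $C,D$, $R_C(D)$ is the face of $D$ spanned by the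 vertices $v$ of $D$ such that $(D\setminus v)C\neq D$ ($D\setminus v$ the codimension-one face of $D$ missing $v$). A labelling by $I$ assigns labels to vertices so that each chamber's vertices map bijectively to $I$; the type of a face is its label set; the rank of a face is its number of vertices. $h_J(D)=|\{C\in\mathcal{C}: R_C(D)\text{ has type }J\}|$, $h_j(D)=|\{C\in\mathcal{C}: R_C(D)\text{ has rank }j\}|$. $h_J(\Delta)=\sum_{K\subseteq J}(-1)^{|J-K|}f_K(\Delta)$ with $f_K$ the number of faces of type $K$; $h_j(\Delta)$ is defined by $f_j(\Delta)=\sum_{k\le j}\binom{n-k}{n-j}h_k(\Delta)$ with $f_j$ the number of faces of rank $j$. $\sigma_J$ (resp. $\sigma_j$) is the sum of all faces of type $J$ (resp. rank $j$) in the (possibly non-associative) algebra over $\mathbb{Q}$ spanned by $\mathcal{F}$ with the bilinearly extended product; $\sigma_I$ and $\sigma_n$ are the sums of all chambers. -}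

module Defs where

open import Data.Bool using (Bool; true; false; T; not; _∧_; _∨_; if_then_else_)
open import Data.Nat using (ℕ; zero; suc; _∸_; _≤_; _≡ᵇ_)
open import Data.Nat.Combinatorics using () renaming (_C_ to binom)
open import Data.Fin using (Fin)
open import Data.Fin.Subset using (Subset; ∣_∣; _⊆_; _∈_; ⊤; ⊥)
open import Data.Vec using (Vec; []; _∷_; lookup; tabulate; _[_]≔_)
open import Data.List using (List; []; _∷_; _++_; map; filter; length; foldr; allFin; downFrom; zipWith; concatMap)
open import Data.Integer as ℤ using (ℤ; +_)
open import Data.Rational as ℚ using (ℚ; 0ℚ; 1ℚ)
open import Data.Product using (Σ; _×_; _,_; ∃)
open import Relation.Binary.PropositionalEquality using (_≡_; _≢_)
open import Relation.Nullary using (¬_)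
open import Relation.Nullary.Decidable using (⌊_⌋; T?)
open import Data.Fin using (_≟_)
open import Relation.Unary using (Pred)

anyFin : ∀ {m} → (Fin m → Bool) → Bool
anyFin p = foldr (λ i b → p i ∨ b) false (allFin _)

allFinB : ∀ {m} → (Fin m → Bool) → Bool
allFinB p = foldr (λ i b → p i ∧ b) true (allFin _)

_⇒ᵇ_ : Bool → Bool → Bool
a ⇒ᵇ b = not a ∨ b

_==ᵇ_ : Bool → Bool → Bool
true  ==ᵇ b = b
false ==ᵇ b = not b

subB : ∀ {m} → Subset m → Subset m → Bool
subB s t = allFinB (λ v → lookup s v ⇒ᵇ lookup t v)

eqB : ∀ {m} → Subset m → Subset m → Bool
eqB s t = allFinB (λ v → lookup s v ==ᵇ lookup t v)

allSubsets : (m : ℕ) → List (Subset m)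
allSubsets zero    = [] ∷ []
allSubsets (suc m) = map (false ∷_) (allSubsets m) ++ map (true ∷_) (allSubsets m)

count : ∀ {A : Set} → (A → Bool) → List A → ℕ
count p xs = length (filter (λ x → T? (p x)) xs)

sumℤ : List ℤ → ℤ
sumℤ = foldr ℤ._+_ (+ 0)

sumℚ : List ℚ → ℚ
sumℚ = foldr ℚ._+_ 0ℚ

-- Underlying data of a simplicial (possibly non-associative) LRB.
-- Vertices are Fin m; a face is a subset of vertices accepted by isFace.
-- The product is given as an operation on subsets that maps faces to
-- faces; only its values on faces are ever used.

record PreSLRB : Set where
  field
    m       : ℕ
    n       : ℕ                         -- rank of Δ (size of chambers)
    isFace  : Subset m → Bool
    _∙_     : Subset m → Subset m → Subset m
    empty-face   : T (isFace ⊥)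
    down-closed  : ∀ s t → s ⊆ t → T (isFace t) → T (isFace s)
    ∙-closed     : ∀ s t → T (isFace s) → T (isFace t) → T (isFace (s ∙ t))

module _ (P : PreSLRB) where
  open PreSLRB P

  faces : List (Subset m)
  faces = filter (λ s → T? (isFace s)) (allSubsets m)

  IsFace : Subset m → Set
  IsFace s = T (isFace s)

  isChamberB : Subset m → Bool
  isChamberB s = isFace s ∧ foldr (λ t b → (subB s t ⇒ᵇ eqB s t) ∧ b) true faces

  IsChamber : Subset m → Set
  IsChamber s = T (isChamberB s)

  _≼_ : Subset m → Subset m → Set
  x ≼ y = x ∙ y ≡ y

  rank : Subset m → ℕ
  rank = ∣_∣

  IsCodim1Face : Subset m → Subset m → Set
  IsCodim1Face G D = IsFace G × G ⊆ D × suc (rank G) ≡ rank D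

  delete : Subset m → Fin m → Subset m
  delete D v = D [ v ]≔ false

  R : Subset m → Subset m → Subset m
  R C D = tabulate (λ v → lookup D v ∧ not (eqB (delete D v ∙ C) D))

  hRankCh : Subset m → ℕ → ℕ
  hRankCh D j = count (λ C → isChamberB C ∧ (rank (R C D) ≡ᵇ j)) faces

  fRank : ℕ → ℕ
  fRank j = count (λ s → rank s ≡ᵇ j) faces

  -- h_j(Δ), defined by  f_j = Σ_{k ≤ j} C(n-k, n-j) h_k.
  -- Since C(n-j,n-j) = 1 this is solved recursively:
  --   h_j = f_j - Σ_{k < j} C(n-k, n-j) h_k.
  -- hRev j = [h_j, h_{j-1}, ..., h_0].
  hRev : ℕ → List ℤ
  hRev zero    = + fRank 0 ∷ []
  hRev (suc j) =
    (+ fRank (suc j) ℤ.- sumℤ (zipWith (λ k hk → + binom (n ∸ k) (n ∸ suc j) ℤ.* hk)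
                                        (downFrom (suc j)) (hRev j)))
    ∷ hRev j

  hRankΔ : ℕ → ℤ
  hRankΔ j with hRev j
  ... | []    = + 0
  ... | x ∷ _ = x

  -- The (possibly non-associative) algebra over ℚ spanned by the faces:
  -- an element is its coefficient function on faces; product is the
  -- bilinear extension of the face product.

  Alg : Set
  Alg = Subset m → ℚ

  _⊛_ : Alg → Alg → Alg
  (a ⊛ b) H = sumℚ (concatMap (λ F → map (λ G →
                 if eqB (F ∙ G) H then a F ℚ.* b G else 0ℚ) faces) faces)

  σRank : ℕ → Alg
  σRank j s = if isFace s ∧ (rank s ≡ᵇ j) then 1ℚ else 0ℚ

  record Labelling (k : ℕ) : Set where
    field
      lab : Fin m → Fin k
      onto  : ∀ C → IsChamber C → ∀ (i : Fin k) → ∃ λ v → v ∈ C × lab v ≡ i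
      inj   : ∀ C → IsChamber C → ∀ v w → v ∈ C → w ∈ C → lab v ≡ lab w → v ≡ w

  module _ {k : ℕ} (L : Labelling k) where
    open Labelling L

    type : Subset m → Subset k
    type s = tabulate (λ i → anyFin (λ v → lookup s v ∧ ⌊ lab v ≟ i ⌋))

    fType : Subset k → ℕ
    fType K = count (λ s → eqB (type s) K) faces

    hTypeΔ : Subset k → ℤ
    hTypeΔ J = sumℤ (map (λ K → if subB K J
                              then sign (∣ J ∣ ∸ ∣ K ∣) ℤ.* + fType K
                              else + 0) (allSubsets k))
      where sign : ℕ → ℤ
            sign zero          = + 1
            sign (suc zero)    = ℤ.- (+ 1)
            sign (suc (suc t)) = sign t

    hTypeCh : Subset m → Subset k → ℕ
    hTypeCh D J = count (λ C → isChamberB C ∧ eqB (type (R C D)) J) faces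

    σType : Subset k → Alg
    σType J s = if isFace s ∧ eqB (type s) J then 1ℚ else 0ℚ

record IsSimplicialLRB (P : PreSLRB) : Set where
  open PreSLRB P
  field
    identityˡ : ∀ x → IsFace P x → ⊥ ∙ x ≡ x
    identityʳ : ∀ x → IsFace P x → x ∙ ⊥ ≡ x
    xyx-wd    : ∀ x y → IsFace P x → IsFace P y → (x ∙ y) ∙ x ≡ x ∙ (y ∙ x)
    idem      : ∀ x → IsFace P x → x ∙ x ≡ x
    xyx≡xy    : ∀ x y → IsFace P x → IsFace P y → (x ∙ y) ∙ x ≡ x ∙ y
    ≼⇔⊆       : ∀ x y → IsFace P x → IsFace P y → (_≼_ P x y → x ⊆ y) × (x ⊆ y → _≼_ P x y)
    pure      : ∀ C → IsChamber P C → ∣ C ∣ ≡ n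
    chamber-absorb : ∀ C F → IsChamber P C → IsFace P F → C ∙ F ≡ C
    proj-chamber   : ∀ F C → IsFace P F → IsChamber P C → IsChamber P (F ∙ C)

module _ (P : PreSLRB) where
  open PreSLRB P

  data WeakGallery (C : Subset m) : Subset m → Subset m → Set where
    done : ∀ D → IsChamber P D → WeakGallery C D D
    step : ∀ C₁ C₂ D F → IsChamber P C₁ → IsFace P F →
           F ∙ C ≡ C₁ → _≼_ P F C₁ → _≼_ P F C₂ →
           WeakGallery C C₂ D → WeakGallery C C₁ D

record ProjectionAxioms (P : PreSLRB) : Set where
  open PreSLRB P
  field
    P1i   : ∀ F C D → IsFace P F → IsChamber P C → IsChamber P D →
            F ∙ C ≡ D → _≼_ P F D
    P1ii  : ∀ F C → IsFace P F → IsChamber P C → _≼_ P F C → F ∙ C ≡ C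
    P1iii : ∀ F G C D → IsFace P F → IsFace P G → IsChamber P C → IsChamber P D →
            F ∙ C ≡ D → _≼_ P F G → _≼_ P G D → G ∙ C ≡ D
    P2    : ∀ F C D → IsFace P F → IsChamber P C → IsChamber P D → _≼_ P F D →
            (∀ G → IsCodim1Face P G D → _≼_ P F G → G ∙ C ≡ D) → F ∙ C ≡ D
    P3    : ∀ F C C₁ D → IsFace P F → IsChamber P C → IsChamber P D →
            F ∙ C ≡ D → WeakGallery P C C₁ D → F ∙ C₁ ≡ D

{-# OPTIONS --safe #-}

-- The coefficient of a chamber H in σ_𝒞 σ_β (σ_𝒞 the sum of the chambers, β a set of faces) is
-- the number of faces in β, because CF = C for every chamber C; in σ_β σ_𝒞 it is the number of
-- pairs (F, C) with F ∈ β, C a chamber and FC = H.  Both products vanish off the chambers, as FC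
-- is always a chamber.  By (P1) and (P2), for chambers C and D, FC = D holds exactly when
-- R_C(D) ⊆ F ⊆ D.  As D has a unique face of each type J, the pairs for β = {faces of type J}
-- number Σ_{K ⊆ J} h_K(D); as R_C(D) ⊆ F ⊆ D has C(n − k, j − k) solutions F of rank j when
-- R_C(D) has rank k, the pairs for β = {faces of rank j} number Σ_k C(n − k, n − j) h_k(D).
-- So commutation says f_J = Σ_{K ⊆ J} h_K(D), resp. f_j = Σ_k C(n − k, n − j) h_k(D), for every
-- chamber D, and this is h(Δ) = h(D) by Möbius inversion, resp. by solving the unitriangular
-- system that defines h_j(Δ).

module Submission where

open import Algebra.Bundles using (CommutativeSemigroup)
open import Algebra.Core using (Op₂)
import Algebra.Properties.CommutativeSemigroup as CommutativeSemigroupProperties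
open import Algebra.Structures using (IsCommutativeMonoid)
import Data.Bool as Bool
open import Data.Bool using (Bool; true; false; T; not; _∧_; _∨_; if_then_else_)
open import Data.Bool.Properties
  using (T-∧; T-∨; T-≡; T-not-≡; ∧-zeroʳ; ∧-comm; if-∧; if-eta; if-cong; if-cong-then; if-swap-then; if-float)
open import Data.Empty using (⊥-elim)
open import Data.Fin as Fin using (Fin; zero; suc)
open import Data.Fin.Properties using (¬∀⟶∃¬)
open import Data.Fin.Subset using (Subset; _⊆_; _∈_; _∉_; ∣_∣; outside; ⊤)
open import Data.Fin.Subset.Properties using (drop-∷-⊆; p⊆q⇒∣p∣≤∣q∣; ∣p∣≤n; _∈?_; ⊆-antisym; ⊆⊤; ∈⊤)
open import Data.Integer as ℤ using (ℤ; +_; -_)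
import Data.Integer.Properties as ℤ
open import Data.List using (List; []; _∷_; _++_; map; filter; foldr; concatMap; allFin; zipWith; downFrom)
open import Data.List.Properties using (map-++)
open import Data.List.Membership.Propositional using (find) renaming (_∈_ to _∈ₗ_)
open import Data.List.Membership.Propositional.Properties using (∈-filter⁻)
open import Data.List.Relation.Unary.All as All using (All; []; _∷_)
import Data.List.Relation.Unary.All.Properties as All
open import Data.List.Relation.Unary.All.Properties using (¬All⇒Any¬)
open import Data.List.Relation.Unary.Any as Any using (Any)
import Data.List.Relation.Unary.Any.Properties as Any
open import Data.Nat using (ℕ; zero; suc; _+_; _*_; _∸_; _≤_; _<_; z≤n; s≤s; _≡ᵇ_; _≤?_)
open import Data.Nat.Combinatorics using (nCn≡1; nCk+nC[k+1]≡[n+1]C[k+1]; nCk≡nC[n∸k]) renaming (_C_ to binom)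
import Data.Nat.Properties as ℕ
open import Data.Product using (Σ; ∃; _×_; _,_; proj₁; proj₂)
open import Data.Rational as ℚ using (ℚ; 0ℚ; 1ℚ)
import Data.Rational.Properties as ℚ
open import Algebra.Properties.Monoid.Mult ℚ.+-0-monoid using (×-homo-+) renaming (_×_ to _·_)
open import Algebra.Properties.Group ℚ.+-0-group using () renaming (∙-cancelˡ to +-cancelˡ)
open import Data.Sum using (inj₁; inj₂; [_,_]′)
open import Data.Vec using ([]; _∷_; lookup; tabulate; _[_]≔_; here)
open import Data.Vec.Properties
  using (tabulate∘lookup; tabulate-cong; lookup∘tabulate; []=⇒lookup; lookup⇒[]=; ≡-dec; []=-injective;
         []≔-updates; []≔-minimal; lookup∘updateAt′)
open import Function using (_∘_; _⇔_; mk⇔; Equivalence)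
open import Level using (0ℓ)
open import Relation.Binary.PropositionalEquality
open import Relation.Nullary.Decidable using (T?; yes; no; decidable-stable; _→-dec_; ⌊_⌋; toWitness; fromWitness)
open import Relation.Nullary.Negation using (¬_)

open import Defs

open Equivalence using (to; from)

module _ {X : Set} where

  T-foldr-∧ : (p : X → Bool) (xs : List X) → T (foldr (λ x b → p x ∧ b) true xs) ⇔ All (T ∘ p) xs
  T-foldr-∧ p []       = mk⇔ (λ _ → []) (λ _ → _)
  T-foldr-∧ p (x ∷ xs) = mk⇔
    (λ h → let px , rest = to T-∧ h in px ∷ to (T-foldr-∧ p xs) rest)
    (λ { (px ∷ rest) → from T-∧ (px , from (T-foldr-∧ p xs) rest) })

  T-foldr-∨ : (p : X → Bool) (xs : List X) → T (foldr (λ x b → p x ∨ b) false xs) ⇔ Any (T ∘ p) xs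
  T-foldr-∨ p []       = mk⇔ (λ ()) (λ ())
  T-foldr-∨ p (x ∷ xs) = mk⇔
    (λ h → [ Any.here , Any.there ∘ to (T-foldr-∨ p xs) ]′ (to T-∨ h))
    (λ { (Any.here px)    → from T-∨ (inj₁ px)
       ; (Any.there rest) → from T-∨ (inj₂ (from (T-foldr-∨ p xs) rest)) })

T-injective : {a b : Bool} → (T a ⇔ T b) → a ≡ b
T-injective {true}  {true}  _   = refl
T-injective {true}  {false} a⇔b = ⊥-elim (to a⇔b _)
T-injective {false} {true}  a⇔b = ⊥-elim (from a⇔b _)
T-injective {false} {false} _   = refl

T-not : ∀ {b} → T (not b) ⇔ (¬ T b)
T-not {true}  = mk⇔ (λ ()) (λ ¬t → ¬t _)
T-not {false} = mk⇔ (λ _ ()) (λ _ → _)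

¬T⇒≡false : ∀ {b} → ¬ T b → b ≡ false
¬T⇒≡false = to T-not-≡ ∘ from T-not

¬T-⇒ᵇ : ∀ {a b} → ¬ T (a ⇒ᵇ b) → T a × ¬ T b
¬T-⇒ᵇ {true}  {false} _  = _ , λ ()
¬T-⇒ᵇ {true}  {true}  ¬t = ⊥-elim (¬t _)
¬T-⇒ᵇ {false}         ¬t = ⊥-elim (¬t _)

∧-∧-false : ∀ a b → a ∧ b ∧ false ≡ false
∧-∧-false a b = trans (cong (a ∧_) (∧-zeroʳ b)) (∧-zeroʳ a)

if-cong-then-T : ∀ {A : Set} b {x y z : A} → (T b → x ≡ y) →
                 (if b then x else z) ≡ (if b then y else z)
if-cong-then-T true  x≡y = x≡y _
if-cong-then-T false _   = refl

module _ {m : ℕ} where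

  T-allFinB : (p : Fin m → Bool) → T (allFinB p) ⇔ (∀ i → T (p i))
  T-allFinB p = mk⇔ (All.tabulate⁻ ∘ to (T-foldr-∧ p (allFin m)))
                    (from (T-foldr-∧ p (allFin m)) ∘ All.tabulate⁺)

  T-anyFin : (p : Fin m → Bool) → T (anyFin p) ⇔ ∃ (T ∘ p)
  T-anyFin p = mk⇔ (Any.tabulate⁻ ∘ to (T-foldr-∨ p (allFin m)))
                   (λ (i , pᵢ) → from (T-foldr-∨ p (allFin m)) (Any.tabulate⁺ i pᵢ))

allFinB-suc : ∀ {m} (p : Fin (suc m) → Bool) → allFinB p ≡ p zero ∧ allFinB (p ∘ suc)
allFinB-suc p = T-injective (mk⇔
  (λ h → from T-∧ (to (T-allFinB p) h zero , from (T-allFinB (p ∘ suc)) (to (T-allFinB p) h ∘ suc)))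
  (λ h → let p₀ , pₛ = to T-∧ h in
         from (T-allFinB p) λ { zero → p₀ ; (suc i) → to (T-allFinB (p ∘ suc)) pₛ i }))

T-==ᵇ : {a b : Bool} → T (a ==ᵇ b) ⇔ a ≡ b
T-==ᵇ {true}  {true}  = mk⇔ (λ _ → refl) (λ _ → _)
T-==ᵇ {true}  {false} = mk⇔ (λ ()) (λ ())
T-==ᵇ {false} {true}  = mk⇔ (λ ()) (λ ())
T-==ᵇ {false} {false} = mk⇔ (λ _ → refl) (λ _ → _)

T-⇒ᵇ : {a b : Bool} → T (a ⇒ᵇ b) ⇔ (T a → T b)
T-⇒ᵇ {true}  {true}  = mk⇔ (λ _ _ → _) (λ _ → _)
T-⇒ᵇ {true}  {false} = mk⇔ (λ ()) (λ h → h _)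
T-⇒ᵇ {false}         = mk⇔ (λ _ ()) (λ _ → _)

module _ {m : ℕ} where

  ∈⇔T-lookup : {v : Fin m} {s : Subset m} → v ∈ s ⇔ T (lookup s v)
  ∈⇔T-lookup {v} {s} = mk⇔ (from T-≡ ∘ []=⇒lookup) (lookup⇒[]= v s ∘ to T-≡)

  T-eqB : {s t : Subset m} → T (eqB s t) ⇔ s ≡ t
  T-eqB {s} {t} = mk⇔
    (λ h → begin
      s                   ≡⟨ tabulate∘lookup s ⟨
      tabulate (lookup s) ≡⟨ tabulate-cong (λ v → to T-==ᵇ (to (T-allFinB same) h v)) ⟩
      tabulate (lookup t) ≡⟨ tabulate∘lookup t ⟩
      t                   ∎)
    (λ { refl → from (T-allFinB same) (λ v → from (T-==ᵇ {lookup s v}) refl) })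
    where
    open ≡-Reasoning
    same : Fin m → Bool
    same v = lookup s v ==ᵇ lookup t v

  T-subB : {s t : Subset m} → T (subB s t) ⇔ s ⊆ t
  T-subB {s} {t} = mk⇔
    (λ h {v} v∈s → from ∈⇔T-lookup (to T-⇒ᵇ (to (T-allFinB implies) h v) (to ∈⇔T-lookup v∈s)))
    (λ s⊆t → from (T-allFinB implies) (λ v → from T-⇒ᵇ (to ∈⇔T-lookup ∘ s⊆t ∘ from ∈⇔T-lookup)))
    where
    implies : Fin m → Bool
    implies v = lookup s v ⇒ᵇ lookup t v

eqB-∷ : ∀ {m} a b (s t : Subset m) → eqB (a ∷ s) (b ∷ t) ≡ (a ==ᵇ b) ∧ eqB s t
eqB-∷ a b s t = allFinB-suc (λ v → lookup (a ∷ s) v ==ᵇ lookup (b ∷ t) v)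

subB-∷ : ∀ {m} a b (s t : Subset m) → subB (a ∷ s) (b ∷ t) ≡ (a ⇒ᵇ b) ∧ subB s t
subB-∷ a b s t = allFinB-suc (λ v → lookup (a ∷ s) v ⇒ᵇ lookup (b ∷ t) v)

eqB-comm : ∀ {m} (s t : Subset m) → eqB s t ≡ eqB t s
eqB-comm s t = T-injective (mk⇔ (from (T-eqB {s = t} {s}) ∘ sym ∘ to T-eqB)
                                (from (T-eqB {s = s} {t}) ∘ sym ∘ to T-eqB))

-- Finite sums

module ListSum {A : Set} {_∙_ : Op₂ A} {ε : A} (isCM : IsCommutativeMonoid _≡_ _∙_ ε) where
  open IsCommutativeMonoid isCM using (assoc; identityˡ; identityʳ; isCommutativeSemigroup)

  commutativeSemigroup : CommutativeSemigroup 0ℓ 0ℓ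
  commutativeSemigroup = record { isCommutativeSemigroup = isCommutativeSemigroup }

  open CommutativeSemigroupProperties commutativeSemigroup using (interchange)
  open ≡-Reasoning

  ∑ : {X : Set} → List X → (X → A) → A
  ∑ xs f = foldr _∙_ ε (map f xs)

  foldr-++ : (as bs : List A) → foldr _∙_ ε (as ++ bs) ≡ foldr _∙_ ε as ∙ foldr _∙_ ε bs
  foldr-++ []       bs = sym (identityˡ _)
  foldr-++ (a ∷ as) bs = trans (cong (a ∙_) (foldr-++ as bs)) (sym (assoc a _ _))

  module _ {X : Set} where

    ∑-cong : (xs : List X) {f g : X → A} → (∀ x → f x ≡ g x) → ∑ xs f ≡ ∑ xs g
    ∑-cong []       f≗g = refl
    ∑-cong (x ∷ xs) f≗g = cong₂ _∙_ (f≗g x) (∑-cong xs f≗g)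

    ∑-++ : (xs ys : List X) (f : X → A) → ∑ (xs ++ ys) f ≡ ∑ xs f ∙ ∑ ys f
    ∑-++ xs ys f = trans (cong (foldr _∙_ ε) (map-++ f xs ys)) (foldr-++ (map f xs) (map f ys))

    ∑-cong-∈ : (xs : List X) {f g : X → A} → (∀ {x} → x ∈ₗ xs → f x ≡ g x) → ∑ xs f ≡ ∑ xs g
    ∑-cong-∈ []       f≗g = refl
    ∑-cong-∈ (x ∷ xs) f≗g = cong₂ _∙_ (f≗g (Any.here refl)) (∑-cong-∈ xs (f≗g ∘ Any.there))

    ∑-zero : (xs : List X) → ∑ xs (λ _ → ε) ≡ ε
    ∑-zero []       = refl
    ∑-zero (x ∷ xs) = trans (identityˡ _) (∑-zero xs)

    ∑-+ : (xs : List X) (f g : X → A) → ∑ xs (λ x → f x ∙ g x) ≡ ∑ xs f ∙ ∑ xs g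
    ∑-+ []       f g = sym (identityˡ ε)
    ∑-+ (x ∷ xs) f g = trans (cong ((f x ∙ g x) ∙_) (∑-+ xs f g)) (interchange (f x) (g x) _ _)

    ∑-if-false : (xs : List X) {p : X → Bool} {f : X → A} → (∀ x → p x ≡ false) →
                 ∑ xs (λ x → if p x then f x else ε) ≡ ε
    ∑-if-false xs p≗false = trans (∑-cong xs (λ x → cong (if_then _ else ε) (p≗false x))) (∑-zero xs)

    ∑-if : (b : Bool) (xs : List X) (f : X → A) →
           (if b then ∑ xs f else ε) ≡ ∑ xs (λ x → if b then f x else ε)
    ∑-if true  xs f = refl
    ∑-if false xs f = sym (∑-zero xs)

    ∑-filter : (p : X → Bool) (xs : List X) (f : X → A) →
               ∑ (filter (T? ∘ p) xs) f ≡ ∑ xs (λ x → if p x then f x else ε)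
    ∑-filter p []       f = refl
    ∑-filter p (x ∷ xs) f with p x
    ... | true  = cong (f x ∙_) (∑-filter p xs f)
    ... | false = trans (∑-filter p xs f) (sym (identityˡ _))

  module _ {X : Set} where

    foldr-concatMap : (xs : List X) (f : X → List A) →
                      foldr _∙_ ε (concatMap f xs) ≡ ∑ xs (foldr _∙_ ε ∘ f)
    foldr-concatMap []       f = refl
    foldr-concatMap (x ∷ xs) f =
      trans (foldr-++ (f x) (concatMap f xs)) (cong (foldr _∙_ ε (f x) ∙_) (foldr-concatMap xs f))

  module _ {X Y : Set} where

    ∑-map : (h : X → Y) (xs : List X) (f : Y → A) → ∑ (map h xs) f ≡ ∑ xs (f ∘ h)
    ∑-map h []       f = refl
    ∑-map h (x ∷ xs) f = cong (f (h x) ∙_) (∑-map h xs f)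

    ∑-swap : (xs : List X) (ys : List Y) (f : X → Y → A) →
             ∑ xs (λ x → ∑ ys (f x)) ≡ ∑ ys (λ y → ∑ xs (λ x → f x y))
    ∑-swap []       ys f = sym (∑-zero ys)
    ∑-swap (x ∷ xs) ys f = trans (cong (∑ ys (f x) ∙_) (∑-swap xs ys f))
                                 (sym (∑-+ ys (f x) (λ y → ∑ xs (λ x′ → f x′ y))))

  ∑-allSubsets-suc : ∀ {m} (f : Subset (suc m) → A) →
    ∑ (allSubsets (suc m)) f ≡ ∑ (allSubsets m) (f ∘ (false ∷_)) ∙ ∑ (allSubsets m) (f ∘ (true ∷_))
  ∑-allSubsets-suc {m} f = trans (∑-++ (map (false ∷_) S) (map (true ∷_) S) f)
                                 (cong₂ _∙_ (∑-map (false ∷_) S f) (∑-map (true ∷_) S f))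
    where
    S : List (Subset m)
    S = allSubsets m

  ∑-⊆-∷ : ∀ {k} (h : Subset (suc k) → A) b (J : Subset k) →
    ∑ (allSubsets (suc k)) (λ K → if subB K (b ∷ J) then h K else ε)
      ≡ ∑ (allSubsets k) (λ K → if subB K J then h (false ∷ K) else ε)
        ∙ (if b then ∑ (allSubsets k) (λ K → if subB K J then h (true ∷ K) else ε) else ε)
  ∑-⊆-∷ {k} h b J = trans (∑-allSubsets-suc (λ K → if subB K (b ∷ J) then h K else ε)) (cong₂ _∙_
    (∑-cong S (λ K → cong (if_then h (false ∷ K) else ε) (subB-∷ false b K J)))
    (trans (∑-cong S (λ K → cong (if_then h (true ∷ K) else ε) (subB-∷ true b K J))) (upper b)))
    where
    S : List (Subset k)
    S = allSubsets k
    upper : ∀ b → ∑ S (λ K → if (true ⇒ᵇ b) ∧ subB K J then h (true ∷ K) else ε)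
                  ≡ (if b then ∑ S (λ K → if subB K J then h (true ∷ K) else ε) else ε)
    upper true  = refl
    upper false = ∑-zero S

  ∑-allSubsets-δ : ∀ {m} (H : Subset m) (g : Subset m → A) →
    ∑ (allSubsets m) (λ F → if eqB F H then g F else ε) ≡ g H
  ∑-allSubsets-δ []      g = identityʳ (g [])
  ∑-allSubsets-δ {suc m} (b ∷ H) g = begin
    ∑ (allSubsets (suc m)) δ
      ≡⟨ ∑-allSubsets-suc δ ⟩
    ∑ S (δ ∘ (false ∷_)) ∙ ∑ S (δ ∘ (true ∷_))
      ≡⟨ cong₂ _∙_ (∑-cong S (λ F → cong (if_then g (false ∷ F) else ε) (eqB-∷ false b F H)))
                   (∑-cong S (λ F → cong (if_then g (true ∷ F) else ε) (eqB-∷ true b F H))) ⟩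
    ∑ S (λ F → if (false ==ᵇ b) ∧ eqB F H then g (false ∷ F) else ε)
      ∙ ∑ S (λ F → if (true ==ᵇ b) ∧ eqB F H then g (true ∷ F) else ε)
      ≡⟨ pick b ⟩
    g (b ∷ H) ∎
    where
    S : List (Subset m)
    S = allSubsets m
    δ : Subset (suc m) → A
    δ F = if eqB F (b ∷ H) then g F else ε
    pick : ∀ b → ∑ S (λ F → if (false ==ᵇ b) ∧ eqB F H then g (false ∷ F) else ε)
                   ∙ ∑ S (λ F → if (true ==ᵇ b) ∧ eqB F H then g (true ∷ F) else ε) ≡ g (b ∷ H)
    pick true  = trans (cong₂ _∙_ (∑-zero S) (∑-allSubsets-δ H (g ∘ (true ∷_)))) (identityˡ _)
    pick false = trans (cong₂ _∙_ (∑-allSubsets-δ H (g ∘ (false ∷_))) (∑-zero S)) (identityʳ _)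

open ListSum ℕ.+-0-isCommutativeMonoid public

module _ {X : Set} where

  count≡∑ : (p : X → Bool) (xs : List X) → count p xs ≡ ∑ xs (λ x → if p x then 1 else 0)
  count≡∑ p []       = refl
  count≡∑ p (x ∷ xs) with p x
  ... | true  = cong suc (count≡∑ p xs)
  ... | false = count≡∑ p xs

  ∑-*ˡ : (xs : List X) (c : ℕ) (f : X → ℕ) → ∑ xs (λ x → c * f x) ≡ c * ∑ xs f
  ∑-*ˡ []       c f = sym (ℕ.*-zeroʳ c)
  ∑-*ˡ (x ∷ xs) c f = trans (cong (_+_ (c * f x)) (∑-*ˡ xs c f)) (sym (ℕ.*-distribˡ-+ c (f x) _))

module _ {X Y : Set} where

  ∑-*-count : (xs : List X) (ys : List Y) (p : Y → Bool) (e : Y → X → Bool) (w : X → ℕ) →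
    ∑ xs (λ x → w x * count (λ y → p y ∧ e y x) ys)
      ≡ ∑ ys (λ y → if p y then ∑ xs (λ x → if e y x then w x else 0) else 0)
  ∑-*-count xs ys p e w = begin
    ∑ xs (λ x → w x * count (λ y → p y ∧ e y x) ys)
      ≡⟨ ∑-cong xs (λ x → cong (w x *_) (count≡∑ _ ys)) ⟩
    ∑ xs (λ x → w x * ∑ ys (λ y → if p y ∧ e y x then 1 else 0))
      ≡⟨ ∑-cong xs (λ x → ∑-*ˡ ys (w x) _) ⟨
    ∑ xs (λ x → ∑ ys (λ y → w x * (if p y ∧ e y x then 1 else 0)))
      ≡⟨ ∑-swap xs ys _ ⟩
    ∑ ys (λ y → ∑ xs (λ x → w x * (if p y ∧ e y x then 1 else 0)))
      ≡⟨ ∑-cong ys (λ y → ∑-cong xs (λ x → weigh (p y) (e y x) (w x))) ⟩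
    ∑ ys (λ y → ∑ xs (λ x → if p y then (if e y x then w x else 0) else 0))
      ≡⟨ ∑-cong ys (λ y → ∑-if (p y) xs _) ⟨
    ∑ ys (λ y → if p y then ∑ xs (λ x → if e y x then w x else 0) else 0) ∎
    where
    open ≡-Reasoning
    weigh : ∀ a b c → c * (if a ∧ b then 1 else 0) ≡ (if a then (if b then c else 0) else 0)
    weigh true  true  c = ℕ.*-identityʳ c
    weigh true  false c = ℕ.*-zeroʳ c
    weigh false _     c = ℕ.*-zeroʳ c

∑-downFrom-δ-out : ∀ {a N} (g : ℕ → ℕ) → N ≤ a → ∑ (downFrom N) (λ k → if a ≡ᵇ k then g k else 0) ≡ 0
∑-downFrom-δ-out {a} {zero}  g _   = refl
∑-downFrom-δ-out {a} {suc N} g N<a =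
  cong₂ _+_ (if-cong (¬T⇒≡false (ℕ.<⇒≢ N<a ∘ sym ∘ ℕ.≡ᵇ⇒≡ a N))) (∑-downFrom-δ-out g (ℕ.<⇒≤ N<a))

∑-downFrom-δ : ∀ {a N} (g : ℕ → ℕ) → a < N → ∑ (downFrom N) (λ k → if a ≡ᵇ k then g k else 0) ≡ g a
∑-downFrom-δ {a} {suc N} g a<1+N with a ℕ.≟ N
... | yes refl = trans (cong₂ _+_ (if-cong (to T-≡ (ℕ.≡⇒≡ᵇ a a refl))) (∑-downFrom-δ-out {a} g ℕ.≤-refl))
                       (ℕ.+-identityʳ (g a))
... | no a≢N   = cong₂ _+_ (if-cong (¬T⇒≡false (a≢N ∘ ℕ.≡ᵇ⇒≡ a N)))
                          (∑-downFrom-δ g (ℕ.≤∧≢⇒< (ℕ.≤-pred a<1+N) a≢N))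

-- Subsets and their cardinalities

p⊆q∧p≢q⇒∣p∣<∣q∣ : ∀ {n} {p q : Subset n} → p ⊆ q → p ≢ q → ∣ p ∣ < ∣ q ∣
p⊆q∧p≢q⇒∣p∣<∣q∣ {p = []}        {[]}        _   p≢q = ⊥-elim (p≢q refl)
p⊆q∧p≢q⇒∣p∣<∣q∣ {p = true ∷ p}  {true ∷ q}  p⊆q p≢q =
  s≤s (p⊆q∧p≢q⇒∣p∣<∣q∣ (drop-∷-⊆ p⊆q) (p≢q ∘ cong (true ∷_)))
p⊆q∧p≢q⇒∣p∣<∣q∣ {p = false ∷ p} {false ∷ q} p⊆q p≢q =
  p⊆q∧p≢q⇒∣p∣<∣q∣ (drop-∷-⊆ p⊆q) (p≢q ∘ cong (false ∷_))
p⊆q∧p≢q⇒∣p∣<∣q∣ {p = false ∷ p} {true ∷ q}  p⊆q _   = s≤s (p⊆q⇒∣p∣≤∣q∣ (drop-∷-⊆ p⊆q))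
p⊆q∧p≢q⇒∣p∣<∣q∣ {p = true ∷ p}  {false ∷ q} p⊆q _   with () ← p⊆q here

p⊆q∧∣q∣≤∣p∣⇒p≡q : ∀ {n} {p q : Subset n} → p ⊆ q → ∣ q ∣ ≤ ∣ p ∣ → p ≡ q
p⊆q∧∣q∣≤∣p∣⇒p≡q {p = p} {q} p⊆q ∣q∣≤∣p∣ = decidable-stable (≡-dec Bool._≟_ p q)
  (λ p≢q → ℕ.<⇒≱ (p⊆q∧p≢q⇒∣p∣<∣q∣ p⊆q p≢q) ∣q∣≤∣p∣)

module _ {n : ℕ} {D : Subset n} {v : Fin n} where

  v∉[v]≔outside : v ∉ D [ v ]≔ outside
  v∉[v]≔outside v∈ with () ← []=-injective v∈ ([]≔-updates D v)

  [v]≔outside-⊆ : D [ v ]≔ outside ⊆ D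
  [v]≔outside-⊆ {w} w∈ with w Fin.≟ v
  ... | yes refl = ⊥-elim (v∉[v]≔outside w∈)
  ... | no  w≢v  = lookup⇒[]= w D (trans (sym (lookup∘updateAt′ w v w≢v D)) ([]=⇒lookup w∈))

  ⊆-[v]≔outside : {G : Subset n} → G ⊆ D → v ∉ G → G ⊆ D [ v ]≔ outside
  ⊆-[v]≔outside G⊆D v∉G {w} w∈G =
    []≔-minimal D w v (λ { refl → v∉G w∈G }) (G⊆D w∈G)

  ∣[v]≔outside∣<∣D∣ : v ∈ D → ∣ D [ v ]≔ outside ∣ < ∣ D ∣
  ∣[v]≔outside∣<∣D∣ v∈D =
    p⊆q∧p≢q⇒∣p∣<∣q∣ [v]≔outside-⊆ (λ eq → v∉[v]≔outside (subst (v ∈_) (sym eq) v∈D))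

p⊈q⇒∃∈p∉q : ∀ {n} {p q : Subset n} → ¬ (p ⊆ q) → ∃ λ v → v ∈ p × v ∉ q
p⊈q⇒∃∈p∉q {n} {p} {q} p⊈q =
  let v , ¬[v∈p→v∈q] = ¬∀⟶∃¬ n (λ v → v ∈ p → v ∈ q) (λ v → v ∈? p →-dec v ∈? q) (λ p⊆q → p⊈q (p⊆q _))
  in v , decidable-stable (v ∈? p) (λ v∉p → ¬[v∈p→v∈q] (⊥-elim ∘ v∉p)) ,
     λ v∈q → ¬[v∈p→v∈q] (λ _ → v∈q)

codim1⇒delete : ∀ {n} {G D : Subset n} → G ⊆ D → suc ∣ G ∣ ≡ ∣ D ∣ →
                ∃ λ v → v ∈ D × v ∉ G × G ≡ D [ v ]≔ outside
codim1⇒delete {G = G} {D} G⊆D ∣G∣+1≡∣D∣ =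
  let v , v∈D , v∉G = p⊈q⇒∃∈p∉q D⊈G
      ∣D∖v∣<∣G∣+1 = subst (suc ∣ D [ v ]≔ outside ∣ ≤_) (sym ∣G∣+1≡∣D∣) (∣[v]≔outside∣<∣D∣ v∈D)
  in v , v∈D , v∉G , p⊆q∧∣q∣≤∣p∣⇒p≡q (⊆-[v]≔outside G⊆D v∉G) (ℕ.≤-pred ∣D∖v∣<∣G∣+1)
  where
  D⊈G : ¬ (D ⊆ G)
  D⊈G D⊆G = ℕ.<⇒≱ (ℕ.≤-reflexive ∣G∣+1≡∣D∣) (p⊆q⇒∣p∣≤∣q∣ D⊆G)

-- Counting the sets between two subsets

-- shiftedBinom x a j is C(x, j − a) for a ≤ j and 0 otherwise (truncated subtraction would give 1).
shiftedBinom : ℕ → ℕ → ℕ → ℕ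
shiftedBinom x zero    j       = binom x j
shiftedBinom x (suc a) zero    = 0
shiftedBinom x (suc a) (suc j) = shiftedBinom x a j

shiftedBinom-pascal : ∀ x a j → shiftedBinom (suc x) a j ≡ shiftedBinom x a j + shiftedBinom x (suc a) j
shiftedBinom-pascal x zero    zero    = refl
shiftedBinom-pascal x zero    (suc j) = trans (sym (nCk+nC[k+1]≡[n+1]C[k+1] x j)) (ℕ.+-comm (binom x j) _)
shiftedBinom-pascal x (suc a) zero    = refl
shiftedBinom-pascal x (suc a) (suc j) = shiftedBinom-pascal x a j

shiftedBinom-≤ : ∀ x {a j} → a ≤ j → shiftedBinom x a j ≡ binom x (j ∸ a)
shiftedBinom-≤ x {zero}          _         = refl
shiftedBinom-≤ x {suc a} {suc j} (s≤s a≤j) = shiftedBinom-≤ x a≤j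

shiftedBinom-< : ∀ x {a j} → j < a → shiftedBinom x a j ≡ 0
shiftedBinom-< x {suc a} {zero}  _         = refl
shiftedBinom-< x {suc a} {suc j} (s≤s j<a) = shiftedBinom-< x j<a

#between : ∀ {n} → Subset n → Subset n → ℕ → ℕ
#between {n} S D j = ∑ (allSubsets n) (λ F → if (∣ F ∣ ≡ᵇ j) ∧ subB S F ∧ subB F D then 1 else 0)

#between-∷ : ∀ {n} s d (S D : Subset n) j →
  #between (s ∷ S) (d ∷ D) j
    ≡ ∑ (allSubsets n) (λ F → if (∣ F ∣ ≡ᵇ j) ∧ ((s ⇒ᵇ false) ∧ subB S F) ∧ ((false ⇒ᵇ d) ∧ subB F D)
                              then 1 else 0)
      + ∑ (allSubsets n) (λ F → if (suc ∣ F ∣ ≡ᵇ j) ∧ ((s ⇒ᵇ true) ∧ subB S F) ∧ ((true ⇒ᵇ d) ∧ subB F D)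
                                then 1 else 0)
#between-∷ {n} s d S D j =
  trans (∑-allSubsets-suc (λ F → if (∣ F ∣ ≡ᵇ j) ∧ subB (s ∷ S) F ∧ subB F (d ∷ D) then 1 else 0)) (cong₂ _+_
    (∑-cong (allSubsets n) (λ F → if-cong (cong₂ (λ x y → (∣ F ∣ ≡ᵇ j) ∧ x ∧ y)
                                                 (subB-∷ s false S F) (subB-∷ false d F D))))
    (∑-cong (allSubsets n) (λ F → if-cong (cong₂ (λ x y → (suc ∣ F ∣ ≡ᵇ j) ∧ x ∧ y)
                                                 (subB-∷ s true S F) (subB-∷ true d F D)))))

mutual
  #between-shiftedBinom : ∀ {n} {S D : Subset n} j → S ⊆ D →
                          #between S D j ≡ shiftedBinom (∣ D ∣ ∸ ∣ S ∣) ∣ S ∣ j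
  #between-shiftedBinom {S = []} {[]} zero    _ = refl
  #between-shiftedBinom {S = []} {[]} (suc j) _ = refl
  #between-shiftedBinom {suc n} {false ∷ S} {false ∷ D} j sS⊆dD =
    trans (#between-∷ false false S D j)
      (trans (cong₂ _+_ (#between-shiftedBinom j (drop-∷-⊆ sS⊆dD))
                        (∑-if-false (allSubsets n) (λ F → ∧-∧-false (suc ∣ F ∣ ≡ᵇ j) (subB S F))))
             (ℕ.+-identityʳ _))
  #between-shiftedBinom {S = false ∷ S} {true ∷ D}  j sS⊆dD = begin
    #between (false ∷ S) (true ∷ D) j
      ≡⟨ #between-∷ false true S D j ⟩
    #between S D j + ∑ (allSubsets _) (λ F → if (suc ∣ F ∣ ≡ᵇ j) ∧ subB S F ∧ subB F D then 1 else 0)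
      ≡⟨ cong₂ _+_ (#between-shiftedBinom j S⊆D) (#between⁺-shiftedBinom j S⊆D) ⟩
    shiftedBinom (d ∸ a) a j + shiftedBinom (d ∸ a) (suc a) j
      ≡⟨ shiftedBinom-pascal (d ∸ a) a j ⟨
    shiftedBinom (suc (d ∸ a)) a j
      ≡⟨ cong (λ x → shiftedBinom x a j) (ℕ.+-∸-assoc 1 (p⊆q⇒∣p∣≤∣q∣ S⊆D)) ⟨
    shiftedBinom (suc d ∸ a) a j ∎
    where
    open ≡-Reasoning
    S⊆D : S ⊆ D
    S⊆D = drop-∷-⊆ sS⊆dD
    a d : ℕ
    a = ∣ S ∣
    d = ∣ D ∣
  #between-shiftedBinom {suc n} {true ∷ S}  {true ∷ D}  j sS⊆dD =
    trans (#between-∷ true true S D j)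
      (cong₂ _+_ (∑-if-false (allSubsets n) (λ F → ∧-zeroʳ (∣ F ∣ ≡ᵇ j)))
                 (#between⁺-shiftedBinom j (drop-∷-⊆ sS⊆dD)))
  #between-shiftedBinom {S = true ∷ S}  {false ∷ D} j sS⊆dD with () ← sS⊆dD here

  #between⁺-shiftedBinom : ∀ {n} {S D : Subset n} j → S ⊆ D →
    ∑ (allSubsets n) (λ F → if (suc ∣ F ∣ ≡ᵇ j) ∧ subB S F ∧ subB F D then 1 else 0)
      ≡ shiftedBinom (∣ D ∣ ∸ ∣ S ∣) (suc ∣ S ∣) j
  #between⁺-shiftedBinom {n} zero _   = ∑-zero (allSubsets n)
  #between⁺-shiftedBinom (suc j) S⊆D = #between-shiftedBinom j S⊆D

shiftedBinom≡∑-downFrom : ∀ {n j} a → j ≤ n →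
  shiftedBinom (n ∸ a) a j ≡ ∑ (downFrom (suc j)) (λ k → if a ≡ᵇ k then binom (n ∸ k) (n ∸ j) else 0)
shiftedBinom≡∑-downFrom {n} {j} a j≤n with a ≤? j
... | yes a≤j = begin
  shiftedBinom (n ∸ a) a j                  ≡⟨ shiftedBinom-≤ (n ∸ a) a≤j ⟩
  binom (n ∸ a) (j ∸ a)                     ≡⟨ nCk≡nC[n∸k] (ℕ.∸-monoˡ-≤ a j≤n) ⟩
  binom (n ∸ a) ((n ∸ a) ∸ (j ∸ a))         ≡⟨ cong (binom (n ∸ a)) (trans (ℕ.∸-+-assoc n a (j ∸ a))
                                                                      (cong (n ∸_) (ℕ.m+[n∸m]≡n a≤j))) ⟩
  binom (n ∸ a) (n ∸ j)                     ≡⟨ ∑-downFrom-δ (λ k → binom (n ∸ k) (n ∸ j)) (s≤s a≤j) ⟨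
  ∑ (downFrom (suc j)) (λ k → if a ≡ᵇ k then binom (n ∸ k) (n ∸ j) else 0) ∎
  where open ≡-Reasoning
... | no a≰j = trans (shiftedBinom-< (n ∸ a) (ℕ.≰⇒> a≰j))
                     (sym (∑-downFrom-δ-out (λ k → binom (n ∸ k) (n ∸ j)) (ℕ.≰⇒> a≰j)))

-- Möbius inversion on the Boolean lattice

module ℤΣ = ListSum ℤ.+-0-isCommutativeMonoid
open ℤΣ using () renaming (∑ to ∑ℤ)

-1^_ : ℕ → ℤ
-1^ zero  = + 1
-1^ suc t = - (-1^ t)

module _ {k : ℕ} where

  ζ : (Subset k → ℤ) → Subset k → ℤ
  ζ g J = ∑ℤ (allSubsets k) (λ K → if subB K J then g K else + 0)

  μ : (Subset k → ℤ) → Subset k → ℤ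
  μ g J = ∑ℤ (allSubsets k) (λ K → if subB K J then -1^ (∣ J ∣ ∸ ∣ K ∣) ℤ.* g K else + 0)

  ζ-cong : ∀ {f g} → (∀ K → f K ≡ g K) → ∀ J → ζ f J ≡ ζ g J
  ζ-cong f≗g J = ℤΣ.∑-cong (allSubsets k) (λ K → cong (if subB K J then_else + 0) (f≗g K))

  μ-cong : ∀ {f g} → (∀ K → f K ≡ g K) → ∀ J → μ f J ≡ μ g J
  μ-cong f≗g J =
    ℤΣ.∑-cong (allSubsets k) (λ K → cong (λ x → if subB K J then -1^ (∣ J ∣ ∸ ∣ K ∣) ℤ.* x else + 0) (f≗g K))

  ζ-+ : ∀ f g J → ζ (λ K → f K ℤ.+ g K) J ≡ ζ f J ℤ.+ ζ g J
  ζ-+ f g J = trans (ℤΣ.∑-cong (allSubsets k) (λ K → if-+ (subB K J))) (ℤΣ.∑-+ (allSubsets k) _ _)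
    where
    if-+ : ∀ b {x y} → (if b then x ℤ.+ y else + 0) ≡ (if b then x else + 0) ℤ.+ (if b then y else + 0)
    if-+ true  = refl
    if-+ false = refl

  ζ-neg : ∀ g J → ζ (λ K → - g K) J ≡ - ζ g J
  ζ-neg g J = trans (ℤΣ.∑-cong (allSubsets k) (λ K → sym (if-float -_ (subB K J)))) (∑ℤ-neg (allSubsets k) _)
    where
    ∑ℤ-neg : ∀ (xs : List (Subset k)) f → ∑ℤ xs (λ x → - f x) ≡ - ∑ℤ xs f
    ∑ℤ-neg []       f = refl
    ∑ℤ-neg (x ∷ xs) f = trans (cong (ℤ._+_ (- f x)) (∑ℤ-neg xs f)) (sym (ℤ.neg-distrib-+ (f x) _))

  μ-+ : ∀ f g J → μ (λ K → f K ℤ.+ g K) J ≡ μ f J ℤ.+ μ g J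
  μ-+ f g J =
    trans (ℤΣ.∑-cong (allSubsets k) (λ K → if-*-+ (subB K J) (-1^ (∣ J ∣ ∸ ∣ K ∣)))) (ℤΣ.∑-+ (allSubsets k) _ _)
    where
    if-*-+ : ∀ b s {x y} → (if b then s ℤ.* (x ℤ.+ y) else + 0)
                           ≡ (if b then s ℤ.* x else + 0) ℤ.+ (if b then s ℤ.* y else + 0)
    if-*-+ true  s = ℤ.*-distribˡ-+ s _ _
    if-*-+ false s = refl

ζ-[] : (g : Subset 0 → ℤ) → ζ g [] ≡ g []
ζ-[] g = ℤ.+-identityʳ (g [])

μ-[] : (g : Subset 0 → ℤ) → μ g [] ≡ g []
μ-[] g = trans (ℤ.+-identityʳ _) (ℤ.*-identityˡ (g []))

module _ {k : ℕ} (g : Subset (suc k) → ℤ) (J : Subset k) where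
  private
    g₀ g₁ : Subset k → ℤ
    g₀ = g ∘ (false ∷_)
    g₁ = g ∘ (true ∷_)

  ζ-false : ζ g (false ∷ J) ≡ ζ g₀ J
  ζ-false = trans (ℤΣ.∑-⊆-∷ g false J) (ℤ.+-identityʳ _)

  ζ-true : ζ g (true ∷ J) ≡ ζ g₀ J ℤ.+ ζ g₁ J
  ζ-true = ℤΣ.∑-⊆-∷ g true J

  μ-false : μ g (false ∷ J) ≡ μ g₀ J
  μ-false = trans (ℤΣ.∑-⊆-∷ (λ K → -1^ (∣ J ∣ ∸ ∣ K ∣) ℤ.* g K) false J) (ℤ.+-identityʳ _)

  μ-true : μ g (true ∷ J) ≡ - μ g₀ J ℤ.+ μ g₁ J
  μ-true = trans (ℤΣ.∑-⊆-∷ (λ K → -1^ (suc ∣ J ∣ ∸ ∣ K ∣) ℤ.* g K) true J)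
                 (cong (ℤ._+ μ g₁ J) (trans (ℤΣ.∑-cong (allSubsets k) flip-sign) (ζ-neg _ J)))
    where
    flip-sign : ∀ K → (if subB K J then -1^ (suc ∣ J ∣ ∸ ∣ K ∣) ℤ.* g₀ K else + 0)
                      ≡ (if subB K J then - (-1^ (∣ J ∣ ∸ ∣ K ∣) ℤ.* g₀ K) else + 0)
    flip-sign K with subB K J in K⊆J
    ... | false = refl
    ... | true  = trans (cong (λ t → -1^ t ℤ.* g₀ K) (ℕ.+-∸-assoc 1 (p⊆q⇒∣p∣≤∣q∣ K⊆ᵖJ)))
                        (sym (ℤ.neg-distribˡ-* (-1^ (∣ J ∣ ∸ ∣ K ∣)) (g₀ K)))
      where
      K⊆ᵖJ : K ⊆ J
      K⊆ᵖJ = to T-subB (subst T (sym K⊆J) _)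

-x+[x+y]≡y : ∀ x y → - x ℤ.+ (x ℤ.+ y) ≡ y
-x+[x+y]≡y x y = trans (sym (ℤ.+-assoc (- x) x y)) (trans (cong (ℤ._+ y) (ℤ.+-inverseˡ x)) (ℤ.+-identityˡ y))

x+[-x+y]≡y : ∀ x y → x ℤ.+ (- x ℤ.+ y) ≡ y
x+[-x+y]≡y x y = trans (sym (ℤ.+-assoc x (- x) y)) (trans (cong (ℤ._+ y) (ℤ.+-inverseʳ x)) (ℤ.+-identityˡ y))

μ∘ζ : ∀ {k} (g : Subset k → ℤ) J → μ (ζ g) J ≡ g J
μ∘ζ g []          = trans (μ-[] (ζ g)) (ζ-[] g)
μ∘ζ g (false ∷ J) = trans (μ-false (ζ g) J) (trans (μ-cong (ζ-false g) J) (μ∘ζ (g ∘ (false ∷_)) J))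
μ∘ζ g (true ∷ J)  = begin
  μ (ζ g) (true ∷ J)                                   ≡⟨ μ-true (ζ g) J ⟩
  - μ (ζ g ∘ (false ∷_)) J ℤ.+ μ (ζ g ∘ (true ∷_)) J   ≡⟨ cong₂ (λ x y → - x ℤ.+ y) (μ-cong (ζ-false g) J)
                                                              (trans (μ-cong (ζ-true g) J) (μ-+ (ζ g₀) (ζ g₁) J)) ⟩
  - μ (ζ g₀) J ℤ.+ (μ (ζ g₀) J ℤ.+ μ (ζ g₁) J)         ≡⟨ -x+[x+y]≡y (μ (ζ g₀) J) (μ (ζ g₁) J) ⟩
  μ (ζ g₁) J                                           ≡⟨ μ∘ζ g₁ J ⟩
  g (true ∷ J)                                         ∎
  where
  open ≡-Reasoning
  g₀ g₁ : Subset _ → ℤ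
  g₀ = g ∘ (false ∷_)
  g₁ = g ∘ (true ∷_)

ζ∘μ : ∀ {k} (g : Subset k → ℤ) J → ζ (μ g) J ≡ g J
ζ∘μ g []          = trans (ζ-[] (μ g)) (μ-[] g)
ζ∘μ g (false ∷ J) = trans (ζ-false (μ g) J) (trans (ζ-cong (μ-false g) J) (ζ∘μ (g ∘ (false ∷_)) J))
ζ∘μ g (true ∷ J)  = begin
  ζ (μ g) (true ∷ J)                                   ≡⟨ ζ-true (μ g) J ⟩
  ζ (μ g ∘ (false ∷_)) J ℤ.+ ζ (μ g ∘ (true ∷_)) J     ≡⟨ cong₂ ℤ._+_ (ζ-cong (μ-false g) J)
                                                              (trans (ζ-cong (μ-true g) J) (trans (ζ-+ _ (μ g₁) J)
                                                                 (cong (ℤ._+ ζ (μ g₁) J) (ζ-neg (μ g₀) J)))) ⟩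
  ζ (μ g₀) J ℤ.+ (- ζ (μ g₀) J ℤ.+ ζ (μ g₁) J)         ≡⟨ x+[-x+y]≡y (ζ (μ g₀) J) (ζ (μ g₁) J) ⟩
  ζ (μ g₁) J                                           ≡⟨ ζ∘μ g₁ J ⟩
  g (true ∷ J)                                         ∎
  where
  open ≡-Reasoning
  g₀ g₁ : Subset _ → ℤ
  g₀ = g ∘ (false ∷_)
  g₁ = g ∘ (true ∷_)

möbius-inversion : ∀ {k} (f g : Subset k → ℤ) → (∀ J → μ f J ≡ g J) ⇔ (∀ J → f J ≡ ζ g J)
möbius-inversion f g = mk⇔
  (λ μf≗g J → trans (sym (ζ∘μ f J)) (ζ-cong μf≗g J))
  (λ f≗ζg J → trans (μ-cong f≗ζg J) (μ∘ζ g J))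

ζ-pos : ∀ {k} (h : Subset k → ℕ) J → ζ (+_ ∘ h) J ≡ + ∑ (allSubsets k) (λ K → if subB K J then h K else 0)
ζ-pos {k} h J =
  trans (ℤΣ.∑-cong (allSubsets k) (λ K → sym (if-float +_ (subB K J)))) (sym (pos-∑ (allSubsets k) _))
  where
  pos-∑ : ∀ (xs : List (Subset k)) f → + ∑ xs f ≡ ∑ℤ xs (+_ ∘ f)
  pos-∑ []       f = refl
  pos-∑ (x ∷ xs) f = trans (ℤ.pos-+ (f x) _) (cong (ℤ._+_ (+ f x)) (pos-∑ xs f))

-- The h-vectors of Δ

period-two-unique : {X : Set} (a b : ℕ → X) → a 0 ≡ b 0 → a 1 ≡ b 1 →
  (∀ t → a (suc (suc t)) ≡ a t) → (∀ t → b (suc (suc t)) ≡ b t) → ∀ t → a t ≡ b t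
period-two-unique a b a0 a1 aₚ bₚ zero          = a0
period-two-unique a b a0 a1 aₚ bₚ (suc zero)    = a1
period-two-unique a b a0 a1 aₚ bₚ (suc (suc t)) =
  trans (aₚ t) (trans (period-two-unique a b a0 a1 aₚ bₚ t) (sym (bₚ t)))

module _ (P : PreSLRB) {k : ℕ} (L : Labelling P k) where

  hTypeΔ-summands : (J : Subset k) → Σ (Subset k → ℤ) λ f → hTypeΔ P L J ≡ ℤΣ.∑ (allSubsets k) f
  hTypeΔ-summands J = _ , refl

  -- The sign in hTypeΔ is local to its where-block; abstracting its argument with `with' turns the
  -- summand into a function of a variable t, which the metavariable `summand' can then name.
  mutual
    private
      summand : Subset k → Subset k → ℕ → ℤ
      summand J K = _

    hTypeΔ-summand≡ : ∀ J K → proj₁ (hTypeΔ-summands J) K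
                              ≡ (if subB K J then -1^ (∣ J ∣ ∸ ∣ K ∣) ℤ.* + fType P L K else + 0)
    hTypeΔ-summand≡ J K with ∣ J ∣ ∸ ∣ K ∣
    ... | t = period-two-unique (summand J K) (λ t → if subB K J then -1^ t ℤ.* + fType P L K else + 0)
                refl refl (λ _ → refl)
                (λ t → cong (λ s → if subB K J then s ℤ.* + fType P L K else + 0) (ℤ.neg-involutive (-1^ t))) t

  hTypeΔ≡μ : ∀ J → hTypeΔ P L J ≡ μ (λ K → + fType P L K) J
  hTypeΔ≡μ J = trans (proj₂ (hTypeΔ-summands J)) (ℤΣ.∑-cong (allSubsets k) (hTypeΔ-summand≡ J))

sumℤ-zipWith-weights : ∀ ks (w h : ℕ → ℕ) →
  sumℤ (zipWith (λ k hₖ → + w k ℤ.* hₖ) ks (map (+_ ∘ h) ks)) ≡ + ∑ ks (λ k → w k * h k)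
sumℤ-zipWith-weights []       w h = refl
sumℤ-zipWith-weights (k ∷ ks) w h =
  trans (cong₂ ℤ._+_ (sym (ℤ.pos-* (w k) (h k))) (sumℤ-zipWith-weights ks w h)) (sym (ℤ.pos-+ (w k * h k) _))

pos-minus-pos⇔ : ∀ f w h → (+ f ℤ.- + w ≡ + h) ⇔ (f ≡ h + w)
pos-minus-pos⇔ f w h = mk⇔
  (λ e → ℤ.+-injective (begin
    + f                       ≡⟨ ℤ.+-identityʳ (+ f) ⟨
    + f ℤ.+ + 0               ≡⟨ cong (ℤ._+_ (+ f)) (ℤ.+-inverseˡ (+ w)) ⟨
    + f ℤ.+ (- + w ℤ.+ + w)   ≡⟨ ℤ.+-assoc (+ f) (- + w) (+ w) ⟨
    + f ℤ.- + w ℤ.+ + w       ≡⟨ cong (ℤ._+ + w) e ⟩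
    + h ℤ.+ + w               ≡⟨ ℤ.pos-+ h w ⟨
    + (h + w)                 ∎))
  (λ { refl → trans (ℤ.m-n≡m⊖n (h + w) w) (trans (ℤ.⊖-≥ (ℕ.m≤n+m w h)) (cong (+_) (ℕ.m+n∸n≡m h w))) })
  where open ≡-Reasoning

module RankInversion (P : PreSLRB) where
  open PreSLRB P

  weight : ℕ → ℕ → ℕ
  weight k j = binom (n ∸ k) (n ∸ j)

  private
    headℤ : List ℤ → ℤ
    headℤ []      = + 0
    headℤ (x ∷ _) = x

    hRankΔ≡headℤ : ∀ j → hRankΔ P j ≡ headℤ (hRev P j)
    hRankΔ≡headℤ zero    = refl
    hRankΔ≡headℤ (suc j) = refl

    diagonal : ∀ j x → weight j j * x ≡ x
    diagonal j x = trans (cong (_* x) (nCn≡1 (n ∸ j))) (ℕ.*-identityˡ x)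

    below : ∀ {j} → suc j ≤ n → j ≤ n
    below = ℕ.≤-trans (ℕ.n≤1+n _)

  module _ (h : ℕ → ℕ) where

    private
      W : ℕ → ℕ
      W j = ∑ (downFrom (suc j)) (λ k → weight k (suc j) * h k)

      next⇔ : ∀ j → hRev P j ≡ map (+_ ∘ h) (downFrom (suc j)) →
        (hRankΔ P (suc j) ≡ + h (suc j))
          ⇔ (fRank P (suc j) ≡ ∑ (downFrom (suc (suc j))) (λ k → weight k (suc j) * h k))
      next⇔ j hRev≡ rewrite hRev≡ | sumℤ-zipWith-weights (downFrom (suc j)) (λ k → weight k (suc j)) h
                          | diagonal (suc j) (h (suc j)) = pos-minus-pos⇔ (fRank P (suc j)) (W j) (h (suc j))

      hRev≡⇐hRankΔ : (∀ j → j ≤ n → hRankΔ P j ≡ + h j) →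
                     ∀ j → j ≤ n → hRev P j ≡ map (+_ ∘ h) (downFrom (suc j))
      hRev≡⇐hRankΔ hΔ≡ zero    _   = cong (_∷ []) (hΔ≡ 0 z≤n)
      hRev≡⇐hRankΔ hΔ≡ (suc j) j<n = cong₂ _∷_ (hΔ≡ (suc j) j<n) (hRev≡⇐hRankΔ hΔ≡ j (below j<n))

      hRev≡⇐fRank : (∀ j → j ≤ n → fRank P j ≡ ∑ (downFrom (suc j)) (λ k → weight k j * h k)) →
                    ∀ j → j ≤ n → hRev P j ≡ map (+_ ∘ h) (downFrom (suc j))
      hRev≡⇐fRank f≡ zero    _   =
        cong (λ x → + x ∷ []) (trans (f≡ 0 z≤n) (trans (ℕ.+-identityʳ _) (diagonal 0 (h 0))))
      hRev≡⇐fRank f≡ (suc j) j<n = cong₂ _∷_ (from (next⇔ j earlier) (f≡ (suc j) j<n)) earlier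
        where
        earlier : hRev P j ≡ map (+_ ∘ h) (downFrom (suc j))
        earlier = hRev≡⇐fRank f≡ j (below j<n)

    triangular-inversion :
      (∀ j → j ≤ n → hRankΔ P j ≡ + h j)
        ⇔ (∀ j → j ≤ n → fRank P j ≡ ∑ (downFrom (suc j)) (λ k → weight k j * h k))
    triangular-inversion = mk⇔
      (λ { hΔ≡ zero    _   → trans (ℤ.+-injective (hΔ≡ 0 z≤n)) (sym (trans (ℕ.+-identityʳ _) (diagonal 0 (h 0))))
         ; hΔ≡ (suc j) j<n → to (next⇔ j (hRev≡⇐hRankΔ hΔ≡ j (below j<n))) (hΔ≡ (suc j) j<n) })
      (λ f≡ j j≤n → trans (hRankΔ≡headℤ j) (cong headℤ (hRev≡⇐fRank f≡ j j≤n)))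

-- Faces, chambers and the face algebra

toℚ : ℕ → ℚ
toℚ n = n · 1ℚ

module ℚΣ = ListSum ℚ.+-0-isCommutativeMonoid

toℚ-∑ : {X : Set} (xs : List X) (f : X → ℕ) → toℚ (∑ xs f) ≡ ℚΣ.∑ xs (toℚ ∘ f)
toℚ-∑ []       f = refl
toℚ-∑ (x ∷ xs) f = trans (×-homo-+ 1ℚ (f x) (∑ xs f)) (cong (ℚ._+_ (toℚ (f x))) (toℚ-∑ xs f))

toℚ-nonNegative : ∀ n → 0ℚ ℚ.≤ toℚ n
toℚ-nonNegative zero    = ℚ.≤-refl
toℚ-nonNegative (suc n) = ℚ.+-mono-≤ (ℚ.<⇒≤ (ℚ.positive⁻¹ 1ℚ)) (toℚ-nonNegative n)

toℚ-suc-positive : ∀ n → 0ℚ ℚ.< toℚ (suc n)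
toℚ-suc-positive n = ℚ.+-mono-<-≤ (ℚ.positive⁻¹ 1ℚ) (toℚ-nonNegative n)

toℚ-injective : ∀ {a b} → toℚ a ≡ toℚ b → a ≡ b
toℚ-injective {zero}  {zero}  _ = refl
toℚ-injective {zero}  {suc b} e = ⊥-elim (ℚ.<⇒≢ (toℚ-suc-positive b) e)
toℚ-injective {suc a} {zero}  e = ⊥-elim (ℚ.<⇒≢ (toℚ-suc-positive a) (sym e))
toℚ-injective {suc a} {suc b} e = cong suc (toℚ-injective (+-cancelˡ 1ℚ (toℚ a) (toℚ b) e))

if-indicator-* : ∀ a b e →
  (if e then (if a then 1ℚ else 0ℚ) ℚ.* (if b then 1ℚ else 0ℚ) else 0ℚ) ≡ toℚ (if a ∧ b ∧ e then 1 else 0)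
if-indicator-* true  true  true  = refl
if-indicator-* true  true  false = refl
if-indicator-* true  false true  = refl
if-indicator-* true  false false = refl
if-indicator-* false true  true  = refl
if-indicator-* false true  false = refl
if-indicator-* false false true  = refl
if-indicator-* false false false = refl

module FaceComplex (P : PreSLRB) where
  open PreSLRB P

  ∑-faces : (f : Subset m → ℕ) → ∑ (faces P) f ≡ ∑ (allSubsets m) (λ F → if isFace F then f F else 0)
  ∑-faces = ∑-filter isFace (allSubsets m)

  ∑-faces-δ : (H : Subset m) (g : Subset m → ℕ) →
              ∑ (faces P) (λ F → if eqB F H then g F else 0) ≡ (if isFace H then g H else 0)
  ∑-faces-δ H g = begin
    ∑ (faces P) (λ F → if eqB F H then g F else 0)
      ≡⟨ ∑-faces _ ⟩
    ∑ S (λ F → if isFace F then (if eqB F H then g F else 0) else 0)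
      ≡⟨ ∑-cong S (λ F → if-swap-then (isFace F) (eqB F H)) ⟩
    ∑ S (λ F → if eqB F H then (if isFace F then g F else 0) else 0)
      ≡⟨ ∑-allSubsets-δ H _ ⟩
    (if isFace H then g H else 0) ∎
    where
    open ≡-Reasoning
    S : List (Subset m)
    S = allSubsets m

  ∈faces⇒face : ∀ {F} → F ∈ₗ faces P → IsFace P F
  ∈faces⇒face = proj₂ ∘ ∈-filter⁻ (T? ∘ isFace) {xs = allSubsets m}

  ∑-faces-cong : {f g : Subset m → ℕ} → (∀ F → IsFace P F → f F ≡ g F) → ∑ (faces P) f ≡ ∑ (faces P) g
  ∑-faces-cong f≗g = ∑-cong-∈ (faces P) (λ {F} F∈ → f≗g F (∈faces⇒face F∈))

  count-faces-isFace : (p : Subset m → Bool) → count (λ F → isFace F ∧ p F) (faces P) ≡ count p (faces P)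
  count-faces-isFace p = begin
    count (λ F → isFace F ∧ p F) (faces P)
      ≡⟨ count≡∑ _ (faces P) ⟩
    ∑ (faces P) (λ F → if isFace F ∧ p F then 1 else 0)
      ≡⟨ ∑-faces-cong (λ F F-face → if-cong (cong (_∧ p F) (to T-≡ F-face))) ⟩
    ∑ (faces P) (λ F → if p F then 1 else 0)
      ≡⟨ count≡∑ p (faces P) ⟨
    count p (faces P) ∎
    where open ≡-Reasoning

  σ : (Subset m → Bool) → Alg P
  σ α s = if α s then 1ℚ else 0ℚ

  #products : (α β : Subset m → Bool) → Subset m → ℕ
  #products α β H = ∑ (faces P) (λ F → ∑ (faces P) (λ G → if α F ∧ β G ∧ eqB (F ∙ G) H then 1 else 0))

  σ⊛σ : (α β : Subset m → Bool) (H : Subset m) → _⊛_ P (σ α) (σ β) H ≡ toℚ (#products α β H)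
  σ⊛σ α β H = begin
    _⊛_ P (σ α) (σ β) H
      ≡⟨ ℚΣ.foldr-concatMap (faces P)
           (λ F → map (λ G → if eqB (F ∙ G) H then σ α F ℚ.* σ β G else 0ℚ) (faces P)) ⟩
    ℚΣ.∑ (faces P) (λ F → ℚΣ.∑ (faces P) (λ G → if eqB (F ∙ G) H then σ α F ℚ.* σ β G else 0ℚ))
      ≡⟨ ℚΣ.∑-cong (faces P) (λ F → ℚΣ.∑-cong (faces P) (λ G →
           if-indicator-* (α F) (β G) (eqB (F ∙ G) H))) ⟩
    ℚΣ.∑ (faces P) (λ F → ℚΣ.∑ (faces P) (λ G → toℚ (if α F ∧ β G ∧ eqB (F ∙ G) H then 1 else 0)))
      ≡⟨ ℚΣ.∑-cong (faces P) (λ F → toℚ-∑ (faces P) _) ⟨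
    ℚΣ.∑ (faces P) (λ F → toℚ (∑ (faces P) (λ G → if α F ∧ β G ∧ eqB (F ∙ G) H then 1 else 0)))
      ≡⟨ toℚ-∑ (faces P) _ ⟨
    toℚ (#products α β H) ∎
    where open ≡-Reasoning

  proper-superface : ∀ {F} → IsFace P F → ¬ IsChamber P F →
                     ∃ λ G → IsFace P G × F ⊆ G × ∣ F ∣ < ∣ G ∣
  proper-superface {F} F-face ¬F-chamber =
    let G , G∈faces , ¬maximal = find (¬All⇒Any¬ (T? ∘ maximalAt) (faces P) ¬all)
        F⊆ᵇG , F≢G = ¬T-⇒ᵇ ¬maximal
        F⊆G = to (T-subB {s = F} {G}) F⊆ᵇG
    in G , ∈faces⇒face G∈faces , F⊆G ,
       p⊆q∧p≢q⇒∣p∣<∣q∣ F⊆G (F≢G ∘ from T-eqB)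
    where
    maximalAt : Subset m → Bool
    maximalAt t = subB F t ⇒ᵇ eqB F t
    ¬all : ¬ All (T ∘ maximalAt) (faces P)
    ¬all all = ¬F-chamber (from T-∧ (F-face , from (T-foldr-∧ maximalAt (faces P)) all))

  chamber-above : ∀ {F} → IsFace P F → ∃ λ C → IsChamber P C × F ⊆ C
  chamber-above {F} = search (suc m) (ℕ.m≤m+n (suc m) ∣ F ∣)
    where
    search : ∀ fuel {F} → m < fuel + ∣ F ∣ → IsFace P F → ∃ λ C → IsChamber P C × F ⊆ C
    search zero       {F} bound _ = ⊥-elim (ℕ.<⇒≱ bound (∣p∣≤n F))
    search (suc fuel) {F} bound F-face with T? (isChamberB P F)
    ... | yes F-chamber = F , F-chamber , λ x → x
    ... | no ¬F-chamber =
      let G , G-face , F⊆G , ∣F∣<∣G∣ = proper-superface F-face ¬F-chamber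
          C , C-chamber , G⊆C =
            search fuel (ℕ.≤-<-trans (ℕ.≤-pred bound) (ℕ.+-monoʳ-< fuel ∣F∣<∣G∣)) G-face
      in C , C-chamber , G⊆C ∘ F⊆G

-- Projections in a simplicial LRB

module SimplicialLRB (P : PreSLRB) (SL : IsSimplicialLRB P) (PA : ProjectionAxioms P) where
  open PreSLRB P
  open IsSimplicialLRB SL
  open ProjectionAxioms PA
  open FaceComplex P
  open RankInversion P using (weight; triangular-inversion)

  ofRank : ℕ → Subset m → Bool
  ofRank j s = isFace s ∧ (∣ s ∣ ≡ᵇ j)

  chamber⇒face : ∀ {C} → IsChamber P C → IsFace P C
  chamber⇒face = proj₁ ∘ to T-∧

  ≼⇒⊆ : ∀ {F G} → IsFace P F → IsFace P G → _≼_ P F G → F ⊆ G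
  ≼⇒⊆ F-face G-face = proj₁ (≼⇔⊆ _ _ F-face G-face)

  ⊆⇒≼ : ∀ {F G} → IsFace P F → IsFace P G → F ⊆ G → _≼_ P F G
  ⊆⇒≼ F-face G-face = proj₂ (≼⇔⊆ _ _ F-face G-face)

  isChamberB≡rank : ∀ s → isChamberB P s ≡ ofRank n s
  isChamberB≡rank s = T-injective (mk⇔
    (λ s-chamber → from T-∧ (chamber⇒face s-chamber , ℕ.≡⇒≡ᵇ ∣ s ∣ n (pure s s-chamber)))
    (λ h → let s-face , ∣s∣≡ᵇn = to T-∧ h
               C , C-chamber , s⊆C = chamber-above s-face
               ∣C∣≤∣s∣ = ℕ.≤-reflexive (trans (pure C C-chamber) (sym (ℕ.≡ᵇ⇒≡ ∣ s ∣ n ∣s∣≡ᵇn)))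
           in subst (IsChamber P) (sym (p⊆q∧∣q∣≤∣p∣⇒p≡q s⊆C ∣C∣≤∣s∣)) C-chamber))

  ∈R⇔ : ∀ {C D v} → v ∈ R P C D ⇔ (v ∈ D × delete P D v ∙ C ≢ D)
  ∈R⇔ {C} {D} {v} = mk⇔
    (λ v∈R → let v∈D , moves = to T-∧ (subst T (lookup∘tabulate _ v) (to ∈⇔T-lookup v∈R))
             in from ∈⇔T-lookup v∈D , to T-not moves ∘ from T-eqB)
    (λ (v∈D , moves) → from ∈⇔T-lookup (subst T (sym (lookup∘tabulate _ v))
       (from T-∧ (to ∈⇔T-lookup v∈D , from T-not (moves ∘ to T-eqB)))))

  R⊆D : ∀ {C D} → R P C D ⊆ D
  R⊆D = proj₁ ∘ to ∈R⇔

  projection⇒ : ∀ {F C D} → IsFace P F → IsChamber P C → IsChamber P D →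
                F ∙ C ≡ D → F ⊆ D × R P C D ⊆ F
  projection⇒ {F} {C} {D} F-face C-chamber D-chamber FC≡D = F⊆D , R⊆F
    where
    D-face : IsFace P D
    D-face = chamber⇒face D-chamber
    F⊆D : F ⊆ D
    F⊆D = ≼⇒⊆ F-face D-face (P1i F C D F-face C-chamber D-chamber FC≡D)
    R⊆F : R P C D ⊆ F
    R⊆F {v} v∈R = decidable-stable (v ∈? F) λ v∉F →
      let D∖v-face = down-closed (delete P D v) D [v]≔outside-⊆ D-face
      in proj₂ (to ∈R⇔ v∈R)
           (P1iii F (delete P D v) C D F-face D∖v-face C-chamber D-chamber FC≡D
              (⊆⇒≼ F-face D∖v-face (⊆-[v]≔outside F⊆D v∉F))
              (⊆⇒≼ D∖v-face D-face [v]≔outside-⊆))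

  projection⇐ : ∀ {F C D} → IsFace P F → IsChamber P C → IsChamber P D →
                F ⊆ D → R P C D ⊆ F → F ∙ C ≡ D
  projection⇐ {F} {C} {D} F-face C-chamber D-chamber F⊆D R⊆F =
    P2 F C D F-face C-chamber D-chamber (⊆⇒≼ F-face (chamber⇒face D-chamber) F⊆D) facet-projects
    where
    facet-projects : ∀ G → IsCodim1Face P G D → _≼_ P F G → G ∙ C ≡ D
    facet-projects G (G-face , G⊆D , ∣G∣+1≡∣D∣) F≼G =
      let v , v∈D , v∉G , G≡D∖v = codim1⇒delete G⊆D ∣G∣+1≡∣D∣
          v∉R = v∉G ∘ ≼⇒⊆ F-face G-face F≼G ∘ R⊆F
      in subst (λ G → G ∙ C ≡ D) (sym G≡D∖v)
           (decidable-stable (≡-dec Bool._≟_ _ D) (λ moves → v∉R (from ∈R⇔ (v∈D , moves))))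

  eqB-projection : ∀ {F C D} → IsFace P F → IsChamber P C → IsChamber P D →
                   eqB (F ∙ C) D ≡ subB F D ∧ subB (R P C D) F
  eqB-projection F-face C-chamber D-chamber = T-injective (mk⇔
    (λ FC≡D → let F⊆D , R⊆F = projection⇒ F-face C-chamber D-chamber (to T-eqB FC≡D)
              in from T-∧ (from T-subB F⊆D , from T-subB R⊆F))
    (λ h → let F⊆D , R⊆F = to T-∧ h
           in from T-eqB (projection⇐ F-face C-chamber D-chamber (to T-subB F⊆D) (to T-subB R⊆F))))

  eqB-projection-nonChamber : ∀ {F C H} → IsFace P F → IsChamber P C → ¬ IsChamber P H →
                              eqB (F ∙ C) H ≡ false
  eqB-projection-nonChamber {F} {C} F-face C-chamber ¬H-chamber = ¬T⇒≡false λ FC≡H →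
    ¬H-chamber (subst (IsChamber P) (to T-eqB FC≡H) (proj-chamber F C F-face C-chamber))

  #proj : (Subset m → Bool) → Subset m → ℕ
  #proj β D = ∑ (faces P) (λ C → if isChamberB P C then count (λ F → β F ∧ eqB (F ∙ C) D) (faces P) else 0)

  #proj-nonChamber : ∀ β {H} → ¬ IsChamber P H → #proj β H ≡ 0
  #proj-nonChamber β {H} ¬H-chamber =
    trans (∑-cong (faces P) (λ C → trans (if-cong-then-T (isChamberB P C) no-projection) (if-eta (isChamberB P C))))
          (∑-zero (faces P))
    where
    no-projection : ∀ {C} → IsChamber P C → count (λ F → β F ∧ eqB (F ∙ C) H) (faces P) ≡ 0
    no-projection C-chamber = trans (count≡∑ _ (faces P)) (trans
      (∑-faces-cong λ F F-face →
         if-cong (trans (cong (β F ∧_) (eqB-projection-nonChamber F-face C-chamber ¬H-chamber)) (∧-zeroʳ (β F))))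
      (∑-zero (faces P)))

  module _ {α : Subset m → Bool} (α≗isChamberB : ∀ s → α s ≡ isChamberB P s) where

    #products-chamberˡ : ∀ β H → #products α β H ≡ (if isChamberB P H then count β (faces P) else 0)
    #products-chamberˡ β H = begin
      ∑ (faces P) (λ F → ∑ (faces P) (λ G → if α F ∧ β G ∧ eqB (F ∙ G) H then 1 else 0))
        ≡⟨ ∑-faces-cong (λ F _ → ∑-faces-cong (λ G → absorb F G)) ⟩
      ∑ (faces P) (λ F → ∑ (faces P) (λ G → if eqB F H ∧ α F then (if β G then 1 else 0) else 0))
        ≡⟨ ∑-cong (faces P) (λ F → sym (∑-if (eqB F H ∧ α F) (faces P) _)) ⟩
      ∑ (faces P) (λ F → if eqB F H ∧ α F then #β else 0)
        ≡⟨ ∑-cong (faces P) (λ F → if-∧ (eqB F H)) ⟩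
      ∑ (faces P) (λ F → if eqB F H then (if α F then #β else 0) else 0)
        ≡⟨ ∑-faces-δ H _ ⟩
      (if isFace H then (if α H then #β else 0) else 0)
        ≡⟨ if-∧ (isFace H) ⟨
      (if isFace H ∧ α H then #β else 0)
        ≡⟨ if-cong (trans (cong (isFace H ∧_) (α≗isChamberB H)) (∧-isChamberB H)) ⟩
      (if isChamberB P H then #β else 0)
        ≡⟨ if-cong-then (isChamberB P H) (count≡∑ β (faces P)) ⟨
      (if isChamberB P H then count β (faces P) else 0) ∎
      where
      open ≡-Reasoning
      #β : ℕ
      #β = ∑ (faces P) (λ G → if β G then 1 else 0)
      ∧-isChamberB : ∀ s → isFace s ∧ isChamberB P s ≡ isChamberB P s
      ∧-isChamberB s with isFace s
      ... | true  = refl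
      ... | false = refl
      absorb : ∀ F G → IsFace P G →
               (if α F ∧ β G ∧ eqB (F ∙ G) H then 1 else 0)
                 ≡ (if eqB F H ∧ α F then (if β G then 1 else 0) else 0)
      absorb F G G-face with α F in αF
      ... | false = if-cong (sym (∧-zeroʳ (eqB F H)))
      ... | true rewrite chamber-absorb F G (from T-≡ (trans (sym (α≗isChamberB F)) αF)) G-face
                 with β G | eqB F H
      ...   | true  | true  = refl
      ...   | true  | false = refl
      ...   | false | true  = refl
      ...   | false | false = refl

    #products-chamberʳ : ∀ β H → #products β α H ≡ #proj β H
    #products-chamberʳ β H = begin
      ∑ (faces P) (λ F → ∑ (faces P) (λ G → if β F ∧ α G ∧ eqB (F ∙ G) H then 1 else 0))
        ≡⟨ ∑-swap (faces P) (faces P) _ ⟩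
      ∑ (faces P) (λ G → ∑ (faces P) (λ F → if β F ∧ α G ∧ eqB (F ∙ G) H then 1 else 0))
        ≡⟨ ∑-cong (faces P) (λ G → ∑-cong (faces P) (λ F → pull-out (β F) (α G))) ⟩
      ∑ (faces P) (λ G → ∑ (faces P) (λ F → if α G then (if β F ∧ eqB (F ∙ G) H then 1 else 0) else 0))
        ≡⟨ ∑-cong (faces P) (λ G → sym (∑-if (α G) (faces P) _)) ⟩
      ∑ (faces P) (λ G → if α G then ∑ (faces P) (λ F → if β F ∧ eqB (F ∙ G) H then 1 else 0) else 0)
        ≡⟨ ∑-cong (faces P) (λ G → trans (if-cong (α≗isChamberB G))
                                           (if-cong-then (isChamberB P G) (sym (count≡∑ _ (faces P))))) ⟩
      #proj β H ∎
      where
      open ≡-Reasoning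
      pull-out : ∀ b a {e} → (if b ∧ a ∧ e then 1 else 0) ≡ (if a then (if b ∧ e then 1 else 0) else 0)
      pull-out true  true  = refl
      pull-out true  false = refl
      pull-out false true  = refl
      pull-out false false = refl

    σ-chambers-comm⇔ : ∀ β → (∀ H → _⊛_ P (σ α) (σ β) H ≡ _⊛_ P (σ β) (σ α) H)
                           ⇔ (∀ D → IsChamber P D → count β (faces P) ≡ #proj β D)
    σ-chambers-comm⇔ β = mk⇔
      (λ commute D D-chamber → begin
        count β (faces P)                                   ≡⟨ if-cong (to T-≡ D-chamber) ⟨
        (if isChamberB P D then count β (faces P) else 0)   ≡⟨ #products-chamberˡ β D ⟨
        #products α β D                                     ≡⟨ toℚ-injective (begin
          toℚ (#products α β D)                               ≡⟨ σ⊛σ α β D ⟨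
          _⊛_ P (σ α) (σ β) D                                 ≡⟨ commute D ⟩
          _⊛_ P (σ β) (σ α) D                                 ≡⟨ σ⊛σ β α D ⟩
          toℚ (#products β α D)                               ∎) ⟩
        #products β α D                                     ≡⟨ #products-chamberʳ β D ⟩
        #proj β D                                           ∎)
      (λ counts H → begin
        _⊛_ P (σ α) (σ β) H                                 ≡⟨ σ⊛σ α β H ⟩
        toℚ (#products α β H)                               ≡⟨ cong toℚ (#products-chamberˡ β H) ⟩
        toℚ (if isChamberB P H then count β (faces P) else 0) ≡⟨ cong toℚ (on-chambers counts H) ⟩
        toℚ (#proj β H)                                     ≡⟨ cong toℚ (#products-chamberʳ β H) ⟨
        toℚ (#products β α H)                               ≡⟨ σ⊛σ β α H ⟨
        _⊛_ P (σ β) (σ α) H                                 ∎)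
      where
      open ≡-Reasoning
      on-chambers : (∀ D → IsChamber P D → count β (faces P) ≡ #proj β D) →
                    ∀ H → (if isChamberB P H then count β (faces P) else 0) ≡ #proj β H
      on-chambers counts H with T? (isChamberB P H)
      ... | yes H-chamber = trans (if-cong (to T-≡ H-chamber)) (counts H H-chamber)
      ... | no ¬H-chamber = trans (if-cong (¬T⇒≡false ¬H-chamber)) (sym (#proj-nonChamber β ¬H-chamber))

  module Labelled {k : ℕ} (L : Labelling P k) where
    open Labelling L

    ofType : Subset k → Subset m → Bool
    ofType J s = isFace s ∧ eqB (type P L s) J

    ∈type⇔ : ∀ {s i} → i ∈ type P L s ⇔ ∃ λ v → v ∈ s × lab v ≡ i
    ∈type⇔ {s} {i} = mk⇔
      (λ i∈type → let v , witness = to (T-anyFin labelled)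
                                      (subst T (lookup∘tabulate _ i) (to ∈⇔T-lookup i∈type))
                      v∈s , lab≡ = to T-∧ witness
                  in v , from ∈⇔T-lookup v∈s , toWitness lab≡)
      (λ (v , v∈s , lab≡) → from ∈⇔T-lookup (subst T (sym (lookup∘tabulate _ i))
         (from (T-anyFin labelled) (v , from T-∧ (to ∈⇔T-lookup v∈s , fromWitness lab≡)))))
      where
      labelled : Fin m → Bool
      labelled v = lookup s v ∧ ⌊ lab v Fin.≟ i ⌋

    lab∈type : ∀ {s v} → v ∈ s → lab v ∈ type P L s
    lab∈type v∈s = from ∈type⇔ (_ , v∈s , refl)

    isChamberB≡fullType : ∀ s → isChamberB P s ≡ ofType ⊤ s
    isChamberB≡fullType s = T-injective (mk⇔
      (λ s-chamber → from T-∧ (chamber⇒face s-chamber , from T-eqB (⊆-antisym ⊆⊤ (λ {i} _ →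
         let v , v∈s , lab≡ = onto s s-chamber i in from ∈type⇔ (v , v∈s , lab≡)))))
      (λ h → let s-face , full = to T-∧ h
                 C , C-chamber , s⊆C = chamber-above s-face
                 C⊆s : C ⊆ s
                 C⊆s {w} w∈C =
                   let v , v∈s , lab≡ = to ∈type⇔ (subst (lab w ∈_) (sym (to T-eqB full)) ∈⊤)
                   in subst (_∈ s) (inj C C-chamber v w (s⊆C v∈s) w∈C lab≡) v∈s
             in subst (IsChamber P) (⊆-antisym C⊆s s⊆C) C-chamber))

    faceOfType : Subset m → Subset k → Subset m
    faceOfType D J = tabulate (λ v → lookup D v ∧ lookup J (lab v))

    ∈faceOfType⇔ : ∀ {D J v} → v ∈ faceOfType D J ⇔ (v ∈ D × lab v ∈ J)
    ∈faceOfType⇔ {D} {J} {v} = mk⇔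
      (λ v∈ → let v∈D , lab∈J = to T-∧ (subst T (lookup∘tabulate _ v) (to ∈⇔T-lookup v∈))
              in from ∈⇔T-lookup v∈D , from ∈⇔T-lookup lab∈J)
      (λ (v∈D , lab∈J) → from ∈⇔T-lookup (subst T (sym (lookup∘tabulate _ v))
         (from T-∧ (to ∈⇔T-lookup v∈D , to ∈⇔T-lookup lab∈J))))

    faceOfType-⊆ : ∀ {D J} → faceOfType D J ⊆ D
    faceOfType-⊆ {D} {J} = proj₁ ∘ to (∈faceOfType⇔ {D} {J})

    type-faceOfType : ∀ {D J} → IsChamber P D → type P L (faceOfType D J) ≡ J
    type-faceOfType {D} {J} D-chamber = ⊆-antisym
      (λ {i} i∈type → let v , v∈ , lab≡ = to ∈type⇔ i∈type
                      in subst (_∈ J) lab≡ (proj₂ (to (∈faceOfType⇔ {D}) v∈)))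
      (λ {i} i∈J → let v , v∈D , lab≡ = onto D D-chamber i
                   in from ∈type⇔ (v , from (∈faceOfType⇔ {D}) (v∈D , subst (_∈ J) (sym lab≡) i∈J) ,
                                   lab≡))

    type≡⇒≡faceOfType : ∀ {D J F} → IsChamber P D → F ⊆ D → type P L F ≡ J → F ≡ faceOfType D J
    type≡⇒≡faceOfType {D} {J} {F} D-chamber F⊆D refl = ⊆-antisym
      (λ v∈F → from (∈faceOfType⇔ {D}) (F⊆D v∈F , lab∈type v∈F))
      (λ {v} v∈ → let v∈D , lab∈type = to (∈faceOfType⇔ {D}) v∈
                      w , w∈F , lab≡ = to ∈type⇔ lab∈type
                  in subst (_∈ F) (inj D D-chamber w v (F⊆D w∈F) v∈D lab≡) w∈F)

    ⊆faceOfType⇔ : ∀ {D J S} → S ⊆ D → S ⊆ faceOfType D J ⇔ type P L S ⊆ J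
    ⊆faceOfType⇔ {D} {J} {S} S⊆D = mk⇔
      (λ S⊆ {i} i∈type → let v , v∈S , lab≡ = to ∈type⇔ i∈type
                         in subst (_∈ J) lab≡ (proj₂ (to (∈faceOfType⇔ {D}) (S⊆ v∈S))))
      (λ type⊆J {v} v∈S → from (∈faceOfType⇔ {D}) (S⊆D v∈S , type⊆J (lab∈type v∈S)))

    labelled-projection : ∀ {F C D J} → IsFace P F → IsChamber P C → IsChamber P D →
      eqB (type P L F) J ∧ eqB (F ∙ C) D ≡ eqB F (faceOfType D J) ∧ subB (type P L (R P C D)) J
    labelled-projection {F} {C} {D} {J} F-face C-chamber D-chamber = T-injective (mk⇔
      (λ h → let type≡J , FC≡D = to T-∧ h
                 F⊆D , R⊆F = projection⇒ F-face C-chamber D-chamber (to T-eqB FC≡D)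
                 F≡G = type≡⇒≡faceOfType {J = J} D-chamber F⊆D (to T-eqB type≡J)
             in from T-∧ (from T-eqB F≡G ,
                          from T-subB (to (⊆faceOfType⇔ {J = J} R⊆D) (subst (R P C D ⊆_) F≡G R⊆F))))
      (λ h → let F≡ᵇG , type⊆J = to T-∧ h
                 F≡G = to T-eqB F≡ᵇG
                 F⊆D = subst (_⊆ D) (sym F≡G) (faceOfType-⊆ {D} {J})
                 R⊆F = subst (R P C D ⊆_) (sym F≡G) (from (⊆faceOfType⇔ {J = J} R⊆D) (to T-subB type⊆J))
             in from T-∧ (from T-eqB (trans (cong (type P L) F≡G) (type-faceOfType {J = J} D-chamber)) ,
                          from T-eqB (projection⇐ F-face C-chamber D-chamber F⊆D R⊆F))))

    #proj-type-summand : ∀ {C D} J → IsChamber P C → IsChamber P D →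
      count (λ F → ofType J F ∧ eqB (F ∙ C) D) (faces P)
        ≡ (if subB (type P L (R P C D)) J then 1 else 0)
    #proj-type-summand {C} {D} J C-chamber D-chamber = begin
      count (λ F → (isFace F ∧ eqB (type P L F) J) ∧ eqB (F ∙ C) D) (faces P)
        ≡⟨ count≡∑ _ (faces P) ⟩
      ∑ (faces P) (λ F → if (isFace F ∧ eqB (type P L F) J) ∧ eqB (F ∙ C) D then 1 else 0)
        ≡⟨ ∑-faces-cong (λ F F-face → trans
             (if-cong (trans (cong (λ b → (b ∧ eqB (type P L F) J) ∧ eqB (F ∙ C) D) (to T-≡ F-face))
                             (labelled-projection {J = J} F-face C-chamber D-chamber)))
             (if-∧ (eqB F G))) ⟩
      ∑ (faces P) (λ F → if eqB F G then (if subB (type P L (R P C D)) J then 1 else 0) else 0)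
        ≡⟨ ∑-faces-δ G _ ⟩
      (if isFace G then (if subB (type P L (R P C D)) J then 1 else 0) else 0)
        ≡⟨ if-cong (to T-≡ (down-closed G D (faceOfType-⊆ {D} {J}) (chamber⇒face D-chamber))) ⟩
      (if subB (type P L (R P C D)) J then 1 else 0) ∎
      where
      open ≡-Reasoning
      G : Subset m
      G = faceOfType D J

    #proj-type : ∀ {D} J → IsChamber P D →
      #proj (ofType J) D ≡ ∑ (allSubsets k) (λ K → if subB K J then hTypeCh P L D K else 0)
    #proj-type {D} J D-chamber = sym (begin
      ∑ SK (λ K → if subB K J then hTypeCh P L D K else 0)
        ≡⟨ ∑-cong SK (λ K → as-product (subB K J)) ⟩
      ∑ SK (λ K → (if subB K J then 1 else 0) * hTypeCh P L D K)
        ≡⟨ ∑-*-count SK (faces P) (isChamberB P) (λ C K → eqB (typeR C) K) _ ⟩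
      ∑ (faces P) (λ C → if isChamberB P C
                           then ∑ SK (λ K → if eqB (typeR C) K then (if subB K J then 1 else 0) else 0) else 0)
        ≡⟨ ∑-cong (faces P) (λ C → if-cong-then (isChamberB P C)
             (trans (∑-cong SK (λ K → if-cong (eqB-comm (typeR C) K))) (∑-allSubsets-δ (typeR C) _))) ⟩
      ∑ (faces P) (λ C → if isChamberB P C then (if subB (typeR C) J then 1 else 0) else 0)
        ≡⟨ ∑-cong (faces P) (λ C → if-cong-then-T (isChamberB P C) (λ C-chamber →
             sym (#proj-type-summand J C-chamber D-chamber))) ⟩
      #proj (ofType J) D ∎)
      where
      open ≡-Reasoning
      SK : List (Subset k)
      SK = allSubsets k
      typeR : Subset m → Subset k
      typeR C = type P L (R P C D)
      as-product : ∀ b {c} → (if b then c else 0) ≡ (if b then 1 else 0) * c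
      as-product true  = sym (ℕ.+-identityʳ _)
      as-product false = refl


    fType≡count : ∀ J → fType P L J ≡ count (ofType J) (faces P)
    fType≡count J = sym (count-faces-isFace (λ s → eqB (type P L s) J))

    hType≡⇔counts : ∀ {D} → IsChamber P D →
      (∀ J → hTypeΔ P L J ≡ + hTypeCh P L D J)
        ⇔ (∀ J → count (ofType J) (faces P) ≡ #proj (ofType J) D)
    hType≡⇔counts {D} D-chamber = mk⇔
      (λ hΔ≡hD J → to (counts J) (to (möbius-inversion _ _) (λ J → trans (sym (hTypeΔ≡μ P L J)) (hΔ≡hD J)) J))
      (λ counts≡ J → trans (hTypeΔ≡μ P L J) (from (möbius-inversion _ _) (λ J → from (counts J) (counts≡ J)) J))
      where
      counts : ∀ J → (+ fType P L J ≡ ζ (+_ ∘ hTypeCh P L D) J)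
                     ⇔ (count (ofType J) (faces P) ≡ #proj (ofType J) D)
      counts J rewrite fType≡count J | ζ-pos (hTypeCh P L D) J | #proj-type J D-chamber =
        mk⇔ ℤ.+-injective (cong (+_))

    hType≡⇔σType-commute :
      (∀ D → IsChamber P D → ∀ J → hTypeΔ P L J ≡ + hTypeCh P L D J)
        ⇔ (∀ J H → _⊛_ P (σType P L ⊤) (σType P L J) H ≡ _⊛_ P (σType P L J) (σType P L ⊤) H)
    hType≡⇔σType-commute = mk⇔
      (λ hΔ≡hD J → from (σ-chambers-comm⇔ (sym ∘ isChamberB≡fullType) (ofType J)) λ D D-chamber →
         to (hType≡⇔counts D-chamber) (hΔ≡hD D D-chamber) J)
      (λ σ-commute D D-chamber → from (hType≡⇔counts D-chamber) λ J →
         to (σ-chambers-comm⇔ (sym ∘ isChamberB≡fullType) (ofType J)) (σ-commute J) D D-chamber)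

  #proj-rank-summand : ∀ {C D} j → IsChamber P C → IsChamber P D →
    count (λ F → ofRank j F ∧ eqB (F ∙ C) D) (faces P) ≡ #between (R P C D) D j
  #proj-rank-summand {C} {D} j C-chamber D-chamber = begin
    count (λ F → (isFace F ∧ (∣ F ∣ ≡ᵇ j)) ∧ eqB (F ∙ C) D) (faces P)
      ≡⟨ count≡∑ _ (faces P) ⟩
    ∑ (faces P) (λ F → if (isFace F ∧ (∣ F ∣ ≡ᵇ j)) ∧ eqB (F ∙ C) D then 1 else 0)
      ≡⟨ ∑-faces _ ⟩
    ∑ (allSubsets m) (λ F → if isFace F then (if ofRank j F ∧ eqB (F ∙ C) D then 1 else 0) else 0)
      ≡⟨ ∑-cong (allSubsets m) between ⟩
    #between (R P C D) D j ∎
    where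
    open ≡-Reasoning
    between : ∀ F → (if isFace F then (if ofRank j F ∧ eqB (F ∙ C) D then 1 else 0) else 0)
                    ≡ (if (∣ F ∣ ≡ᵇ j) ∧ subB (R P C D) F ∧ subB F D then 1 else 0)
    between F with T? (isFace F)
    ... | yes F-face = begin
      (if isFace F then (if (isFace F ∧ (∣ F ∣ ≡ᵇ j)) ∧ eqB (F ∙ C) D then 1 else 0) else 0)
        ≡⟨ if-cong (to T-≡ F-face) ⟩
      (if (isFace F ∧ (∣ F ∣ ≡ᵇ j)) ∧ eqB (F ∙ C) D then 1 else 0)
        ≡⟨ if-cong (cong₂ (λ x y → (x ∧ (∣ F ∣ ≡ᵇ j)) ∧ y) (to T-≡ F-face)
                          (eqB-projection F-face C-chamber D-chamber)) ⟩
      (if (∣ F ∣ ≡ᵇ j) ∧ subB F D ∧ subB (R P C D) F then 1 else 0)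
        ≡⟨ if-cong (cong ((∣ F ∣ ≡ᵇ j) ∧_) (∧-comm (subB F D) _)) ⟩
      (if (∣ F ∣ ≡ᵇ j) ∧ subB (R P C D) F ∧ subB F D then 1 else 0) ∎
    ... | no ¬F-face = begin
      (if isFace F then _ else 0)
        ≡⟨ if-cong (¬T⇒≡false ¬F-face) ⟩
      0
        ≡⟨ if-cong (∧-∧-false (∣ F ∣ ≡ᵇ j) _) ⟨
      (if (∣ F ∣ ≡ᵇ j) ∧ subB (R P C D) F ∧ false then 1 else 0)
        ≡⟨ if-cong (cong (λ b → (∣ F ∣ ≡ᵇ j) ∧ subB (R P C D) F ∧ b) F⊈D) ⟨
      (if (∣ F ∣ ≡ᵇ j) ∧ subB (R P C D) F ∧ subB F D then 1 else 0) ∎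
      where
      F⊈D : subB F D ≡ false
      F⊈D = ¬T⇒≡false (λ F⊆D → ¬F-face (down-closed F D (to T-subB F⊆D) (chamber⇒face D-chamber)))

  #between-R : ∀ {C D} j → IsChamber P D → j ≤ n →
    #between (R P C D) D j ≡ ∑ (downFrom (suc j)) (λ k → if ∣ R P C D ∣ ≡ᵇ k then weight k j else 0)
  #between-R {C} {D} j D-chamber j≤n = begin
    #between (R P C D) D j       ≡⟨ #between-shiftedBinom j (R⊆D {C} {D}) ⟩
    shiftedBinom (∣ D ∣ ∸ a) a j ≡⟨ cong (λ d → shiftedBinom (d ∸ a) a j) (pure D D-chamber) ⟩
    shiftedBinom (n ∸ a) a j     ≡⟨ shiftedBinom≡∑-downFrom a j≤n ⟩
    ∑ (downFrom (suc j)) (λ k → if a ≡ᵇ k then weight k j else 0) ∎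
    where
    open ≡-Reasoning
    a : ℕ
    a = ∣ R P C D ∣

  #proj-rank : ∀ {D} j → IsChamber P D → j ≤ n →
    #proj (ofRank j) D ≡ ∑ (downFrom (suc j)) (λ k → weight k j * hRankCh P D k)
  #proj-rank {D} j D-chamber j≤n = sym (begin
    ∑ (downFrom (suc j)) (λ k → weight k j * hRankCh P D k)
      ≡⟨ ∑-*-count (downFrom (suc j)) (faces P) (isChamberB P) (λ C k → ∣ R P C D ∣ ≡ᵇ k) _ ⟩
    ∑ (faces P) (λ C → if isChamberB P C
                         then ∑ (downFrom (suc j)) (λ k → if ∣ R P C D ∣ ≡ᵇ k then weight k j else 0) else 0)
      ≡⟨ ∑-cong (faces P) (λ C → if-cong-then-T (isChamberB P C) (λ C-chamber →
           sym (trans (#proj-rank-summand j C-chamber D-chamber) (#between-R j D-chamber j≤n)))) ⟩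
    #proj (ofRank j) D ∎)
    where open ≡-Reasoning

  fRank≡count : ∀ j → fRank P j ≡ count (ofRank j) (faces P)
  fRank≡count j = sym (count-faces-isFace (λ s → ∣ s ∣ ≡ᵇ j))

  hRank≡⇔counts : ∀ {D} → IsChamber P D →
    (∀ j → j ≤ n → hRankΔ P j ≡ + hRankCh P D j)
      ⇔ (∀ j → j ≤ n → count (ofRank j) (faces P) ≡ #proj (ofRank j) D)
  hRank≡⇔counts {D} D-chamber = mk⇔
    (λ hΔ≡hD j j≤n → to (counts j j≤n) (to (triangular-inversion (hRankCh P D)) hΔ≡hD j j≤n))
    (λ counts≡ → from (triangular-inversion (hRankCh P D)) λ j j≤n → from (counts j j≤n) (counts≡ j j≤n))
    where
    counts : ∀ j → j ≤ n →
      (fRank P j ≡ ∑ (downFrom (suc j)) (λ k → weight k j * hRankCh P D k))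
        ⇔ (count (ofRank j) (faces P) ≡ #proj (ofRank j) D)
    counts j j≤n rewrite fRank≡count j | #proj-rank j D-chamber j≤n = mk⇔ (λ e → e) (λ e → e)

  hRank≡⇔σRank-commute :
    (∀ D → IsChamber P D → ∀ j → j ≤ n → hRankΔ P j ≡ + hRankCh P D j)
      ⇔ (∀ j → j ≤ n → ∀ H → _⊛_ P (σRank P n) (σRank P j) H ≡ _⊛_ P (σRank P j) (σRank P n) H)
  hRank≡⇔σRank-commute = mk⇔
    (λ hΔ≡hD j j≤n → from (σ-chambers-comm⇔ (sym ∘ isChamberB≡rank) (ofRank j)) λ D D-chamber →
       to (hRank≡⇔counts D-chamber) (hΔ≡hD D D-chamber) j j≤n)
    (λ σ-commute D D-chamber → from (hRank≡⇔counts D-chamber) λ j j≤n →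
       to (σ-chambers-comm⇔ (sym ∘ isChamberB≡rank) (ofRank j)) (σ-commute j j≤n) D D-chamber)

proposition8p1 : (P : PreSLRB) → IsSimplicialLRB P → ProjectionAxioms P →
    ((k : ℕ) (L : Labelling P k) →
       ((D : Subset (PreSLRB.m P)) → IsChamber P D → (J : Subset k) →
          hTypeΔ P L J ≡ + hTypeCh P L D J)
       ⇔
       ((J : Subset k) (H : Subset (PreSLRB.m P)) →
          _⊛_ P (σType P L ⊤) (σType P L J) H ≡ _⊛_ P (σType P L J) (σType P L ⊤) H))
    ×
    (((D : Subset (PreSLRB.m P)) → IsChamber P D → (j : ℕ) → j ≤ PreSLRB.n P →
          hRankΔ P j ≡ + hRankCh P D j)
       ⇔
       ((j : ℕ) → j ≤ PreSLRB.n P → (H : Subset (PreSLRB.m P)) →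
          _⊛_ P (σRank P (PreSLRB.n P)) (σRank P j) H ≡ _⊛_ P (σRank P j) (σRank P (PreSLRB.n P)) H))
proposition8p1 P SL PA = (λ k L → Labelled.hType≡⇔σType-commute L) , hRank≡⇔σRank-commute
  where open SimplicialLRB P SL PA
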